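{- Let $G=(V,E)$ be a graph with $n$ vertices and $m$ edges, let $H$ be any positive integer, let $\mathcal{I}_G$ be the caching instance constructed from $G$ and $H$ as described in the context, and let $d=4mH+2$. If $G$ has an independent set of cardinality $K$, then there is a service of $\mathcal{I}_G$ (under the optional policy) with total savings at least $(d-1)mH+K$.
   Context: General caching under the optional policy: cache size $C$, pages with sizes and costs, a request sequence; a service starts with an empty cache, at every moment the cached pages have total size at most $C$, pages may be evicted at any time for free; a request to a cached page costs nothing, a request to an uncached page $p$ costs $\mathrm{cost}(p)$ and the service may (but need not) load $p$ into the cache. The savings of a service are the sum of the costs of all requested pages (over all requests) minus the cost of the service. Construction of $\mathcal{I}_G$ (all pages have cost 1). Fix an ordering $e_1,\dots,e_m$ of the edges and an ordering of the vertices. Cache size $C=2mH+1$. Pages: for each vertex $v$ a vertex-page $p_v$ of size 1; for each edge $e$ and each $i\in\{1,\dots,H\}$ six edge-pages $\bar a^e_i,\alpha^e_i,a^e_i,b^e_i,\beta^e_i,\bar b^e_i$, where $\alpha^e_i,\beta^e_i$ have size 3 and the other four have size 2. The request sequence consists of an initial block $I$, then for each vertex $v$ in the fixed order: one request to $p_v$, then the $v$-phase, then one request to $p_v$; finally a final block $F$. The $v$-phase consists, for each edge $e$ incident with $v$ (in an arbitrary fixed order), of $2H$ consecutive blocks associated with $e$. For an edge $e=\{u,v\}$ whose $u$-phase precedes its $v$-phase, its blocks in the $u$-phase are named $B^e_{1,1},B^e_{1,2},\dots,B^e_{H,1},B^e_{H,2}$ (in this order) and its blocks in the $v$-phase are named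 $B^e_{1,3},B^e_{1,4},\dots,B^e_{H,3},B^e_{H,4}$ (in this order). There are $4mH+2$ blocks in total. Contents of every block $B$ (including $I$ and $F$): for $k=1,\dots,m$ in this order, with $e=e_k$, first a first round consisting of the first-round requests of groups $i=1,\dots,H$ (in this order), then a second round consisting of the second-round requests of groups $i=1,\dots,H$ (in this order). The requests of group $i$ of edge $e$ in $B$ (given as "first round; second round", each list in the given order) depend on the position of $B$ relative to $B^e_{i,1},B^e_{i,2},B^e_{i,3},B^e_{i,4}$: $B$ before $B^e_{i,1}$: $\bar a^e_i$; nothing. $B=B^e_{i,1}$: $\bar a^e_i,\alpha^e_i$; $b^e_i$. $B=B^e_{i,2}$: $\alpha^e_i,a^e_i$; $b^e_i$. $B$ strictly between $B^e_{i,2}$ and $B^e_{i,3}$: $a^e_i$; $b^e_i$. $B=B^e_{i,3}$: $a^e_i$; $b^e_i,\beta^e_i$. $B=B^e_{i,4}$: $a^e_i$; $\beta^e_i,\bar b^e_i$. $B$ after $B^e_{i,4}$: nothing; $\bar b^e_i$. -}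

module Defs where

open import Data.Nat using (ℕ; zero; suc; _+_; _*_; _∸_; _≤_; _<_; _<ᵇ_; _≡ᵇ_; _≤ᵇ_)
open import Data.Fin using (Fin; toℕ; _≟_)
open import Data.Fin.Subset using (Subset; _∈_; ∣_∣)
open import Data.List using (List; []; _∷_; _++_; concatMap; map; length; lookup)
open import Data.Nat.ListAction using (sum)
open import Data.List.Base using (allFin)
open import Data.Bool using (Bool; true; false; if_then_else_)
open import Data.Product using (_×_; _,_; proj₁; proj₂)
open import Data.Sum using (_⊎_)
open import Relation.Nullary.Decidable using (⌊_⌋)
open import Relation.Binary.PropositionalEquality using (_≡_)
open import Relation.Nullary using (¬_)
open import Data.List.Relation.Unary.Unique.Propositional using (Unique)
import Data.List.Membership.Propositional as LM
open import Data.Fin using (fromℕ<)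

-- Pages of type P, enumerated (each exactly once) by allP; sizes, costs,
-- cache capacity Cap, request sequence rs.  A service is described by the
-- cache contents  state t  at the moment request t (0-based) is served;
-- state (length rs) is the content after the last request.
-- Between request t and request t+1 the service may evict arbitrary
-- pages, and may load r_t only (and only if it was a fault, which is
-- automatic since loading a cached page changes nothing).

module Caching {P : Set} (allP : List P) (size cost : P → ℕ) (Cap : ℕ) (rs : List P) where

  Cache : Set
  Cache = P → Bool

  totalSize : Cache → ℕ
  totalSize S = sum (map (λ p → if S p then size p else 0) allP)

  record Service : Set where
    field
      state       : ℕ → Cache
      startsEmpty : ∀ p → state 0 p ≡ false
      onlyLoadsRequested : ∀ t (h : t < length rs) p → state (suc t) p ≡ true →
                           state t p ≡ true ⊎ p ≡ lookup rs (fromℕ< h)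
      fits        : ∀ t → t ≤ length rs → totalSize (state t) ≤ Cap

  serviceCostFrom : (ℕ → Cache) → ℕ → List P → ℕ
  serviceCostFrom st t [] = 0
  serviceCostFrom st t (r ∷ rs') = (if st t r then 0 else cost r) + serviceCostFrom st (suc t) rs'

  serviceCost : Service → ℕ
  serviceCost s = serviceCostFrom (Service.state s) 0 rs

  savings : Service → ℕ
  savings s = sum (map cost rs) ∸ serviceCost s

-- Graphs: vertices Fin n, edges indexed by Fin m (this index order is
-- the fixed edge order e_1..e_m); vertex order is the order of Fin n.

record Graph (n m : ℕ) : Set where
  field
    edge     : Fin m → Fin n × Fin n
    loopless : ∀ k → ¬ (proj₁ (edge k) ≡ proj₂ (edge k))
    simple   : ∀ k l → (edge k ≡ edge l ⊎ edge k ≡ (proj₂ (edge l) , proj₁ (edge l))) → k ≡ l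

  IncidentTo : Fin n → Fin m → Set
  IncidentTo v k = proj₁ (edge k) ≡ v ⊎ proj₂ (edge k) ≡ v

  IndependentSet : Subset n → Set
  IndependentSet S = ∀ k → ¬ (proj₁ (edge k) ∈ S × proj₂ (edge k) ∈ S)

-- A fixed order of the incident edges of every vertex: a duplicate-free
-- list containing exactly the edges incident with v.
record IncidenceOrder {n m : ℕ} (G : Graph n m) : Set where
  field
    inc      : Fin n → List (Fin m)
    unique   : ∀ v → Unique (inc v)
    complete : ∀ v k → (LM._∈_ k (inc v) → Graph.IncidentTo G v k)
                     × (Graph.IncidentTo G v k → LM._∈_ k (inc v))

data Kind : Set where
  ā α a b β b̄ : Kind

data Page (n m H : ℕ) : Set where
  vtx : Fin n → Page n m H
  ep  : Kind → Fin m → Fin H → Page n m H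

pageSize : ∀ {n m H} → Page n m H → ℕ
pageSize (vtx _) = 1
pageSize (ep α _ _) = 3
pageSize (ep β _ _) = 3
pageSize (ep ā _ _) = 2
pageSize (ep a _ _) = 2
pageSize (ep b _ _) = 2
pageSize (ep b̄ _ _) = 2

pageCost : ∀ {n m H} → Page n m H → ℕ
pageCost _ = 1

allPages : (n m H : ℕ) → List (Page n m H)
allPages n m H =
  map vtx (allFin n) ++
  concatMap (λ κ → concatMap (λ k → map (ep κ k) (allFin H)) (allFin m))
            (ā ∷ α ∷ a ∷ b ∷ β ∷ b̄ ∷ [])

capacity : (m H : ℕ) → ℕ
capacity m H = 2 * m * H + 1

-- block names: I, F, and B^e_{i,j} (j = 1..4)
data J : Set where
  j1 j2 j3 j4 : J

data BName (m H : ℕ) : Set where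
  bI bF : BName m H
  blk   : Fin m → Fin H → J → BName m H

eqJ : J → J → Bool
eqJ j1 j1 = true
eqJ j2 j2 = true
eqJ j3 j3 = true
eqJ j4 j4 = true
eqJ _ _ = false

eqB : ∀ {m H} → BName m H → BName m H → Bool
eqB bI bI = true
eqB bF bF = true
eqB (blk k i j) (blk k' i' j') = if ⌊ k ≟ k' ⌋ then (if ⌊ i ≟ i' ⌋ then eqJ j j' else false) else false
eqB _ _ = false

-- index of the first element satisfying the test (length if none)
indexOf : {A : Set} → (A → Bool) → List A → ℕ
indexOf f [] = 0
indexOf f (x ∷ xs) = if f x then 0 else suc (indexOf f xs)

module Instance {n m : ℕ} (G : Graph n m) (O : IncidenceOrder G) (H : ℕ) where
  open Graph G
  open IncidenceOrder O

  -- the endpoint of edge k whose phase comes first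
  lowEnd : Fin m → Fin n
  lowEnd k = if toℕ (proj₁ (edge k)) ≤ᵇ toℕ (proj₂ (edge k)) then proj₁ (edge k) else proj₂ (edge k)

  phaseBlocks : Fin n → List (BName m H)
  phaseBlocks v = concatMap (λ k → concatMap (λ i →
      if ⌊ v ≟ lowEnd k ⌋ then blk k i j1 ∷ blk k i j2 ∷ [] else blk k i j3 ∷ blk k i j4 ∷ [])
      (allFin H)) (inc v)

  -- all blocks in order: I, phases, F  (4mH+2 of them)
  blockNames : List (BName m H)
  blockNames = bI ∷ (concatMap phaseBlocks (allFin n) ++ bF ∷ [])

  pos : BName m H → ℕ
  pos x = indexOf (eqB x) blockNames

  -- (first round ; second round) requests of group i of edge k in block number t
  group : ℕ → Fin m → Fin H → List (Page n m H) × List (Page n m H)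
  group t k i =
    let p1 = pos (blk k i j1) ; p2 = pos (blk k i j2)
        p3 = pos (blk k i j3) ; p4 = pos (blk k i j4)
        P : Kind → Page n m H
        P κ = ep κ k i in
    if t <ᵇ p1 then (P ā ∷ [] , [])
    else if t ≡ᵇ p1 then (P ā ∷ P α ∷ [] , P b ∷ [])
    else if t ≡ᵇ p2 then (P α ∷ P a ∷ [] , P b ∷ [])
    else if t <ᵇ p3 then (P a ∷ [] , P b ∷ [])
    else if t ≡ᵇ p3 then (P a ∷ [] , P b ∷ P β ∷ [])
    else if t ≡ᵇ p4 then (P a ∷ [] , P β ∷ P b̄ ∷ [])
    else ([] , P b̄ ∷ [])

  content : ℕ → List (Page n m H)
  content t = concatMap (λ k →
      concatMap (λ i → proj₁ (group t k i)) (allFin H) ++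
      concatMap (λ i → proj₂ (group t k i)) (allFin H)) (allFin m)

  contentOf : BName m H → List (Page n m H)
  contentOf x = content (pos x)

  requests : List (Page n m H)
  requests = contentOf bI ++
             (concatMap (λ v → vtx v ∷ (concatMap contentOf (phaseBlocks v) ++ vtx v ∷ []))
                        (allFin n)
              ++ contentOf bF)

  open Caching (allPages n m H) pageSize pageCost (capacity m H) requests public

module Submission where

-- The vertex page p_v stays
-- cached between its two requests exactly when v ∈ S, which saves K.  The
-- six pages of each group (edge e, index i) share a one-page slot, which
-- keeps ā α a b̄ if the first endpoint of e is outside S and ā b β b̄
-- otherwise.  Then every group saves exactly one request in each of the
-- d - 1 blocks after I, and its slot exceeds size 2 (by one unit) only in
-- two blocks of the phase of an endpoint outside S.  As C = 2mH + 1, the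
-- one free unit is thus used inside the v-phase by p_v (v ∈ S) or by the
-- group owning the current block (v ∉ S), never by both.

open import Defs
open import Data.Nat using (ℕ; zero; suc; pred; _+_; _*_; _∸_; _≤_; _<_; _<ᵇ_; _≡ᵇ_; _≤ᵇ_; z≤n; s≤s; _⊔_)
open import Data.Nat.Properties hiding (_≟_)
open import Data.Nat.ListAction using (sum)
open import Data.Nat.ListAction.Properties using (sum-++)
open import Data.Bool using (Bool; true; false; if_then_else_; _∧_; _∨_; not; T)
open import Data.Bool.Properties using (∧-identityʳ; ∧-inverseʳ)
open import Data.Maybe using (Maybe; just; nothing)
open import Data.Fin using (Fin; zero; suc; toℕ; fromℕ<; _≟_)
open import Data.Fin.Patterns using (0F; 1F; 2F; 3F; 4F; 5F)
open import Data.Fin.Properties using (toℕ-injective)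
open import Data.Fin.Subset using (Subset; ∣_∣)
open import Data.Vec using (Vec) renaming (lookup to vlookup)
open import Data.Vec.Properties using (lookup⇒[]=)
open import Data.List using (List; []; _∷_; _++_; take; map; concatMap; length; tabulate; allFin; lookup)
open import Data.List.Properties using (map-tabulate; map-++; length-++; ++-assoc; concatMap-++; length-tabulate; ++-conicalʳ; ++-identityʳ; concatMap-cong; map-∘)
open import Data.List.Membership.Propositional using (_∈_; _∉_; find; lose)
open import Data.List.Membership.Propositional.Properties
  using (∈-++⁺ˡ; ∈-++⁺ʳ; ∈-++⁻; ∈-∃++; ∈-concatMap⁺; ∈-concatMap⁻; ∈-allFin; ∈-map⁺)
open import Data.List.Relation.Unary.Any using (here; there)
open import Data.List.Relation.Unary.All using (All; []; _∷_)
import Data.List.Relation.Unary.All as All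
import Data.List.Relation.Unary.All.Properties as All
open import Data.List.Relation.Unary.AllPairs using ([]; _∷_)
open import Data.List.Relation.Unary.Unique.Propositional using (Unique)
import Data.List.Relation.Unary.Unique.Propositional.Properties as Unique
open import Data.List.Relation.Binary.Disjoint.Propositional using (Disjoint)
open import Data.Product using (Σ; Σ-syntax; ∃; _×_; _,_; proj₁; proj₂)
open import Data.Sum using (_⊎_; inj₁; inj₂)
open import Data.Empty using (⊥; ⊥-elim)
open import Data.Unit using (⊤; tt)
open import Function using (_∘_; case_of_)
open import Relation.Nullary using (¬_; Dec; yes; no; does)
open import Relation.Nullary.Decidable using (⌊_⌋; map′; dec-true; dec-false)
open import Relation.Binary.Definitions using (DecidableEquality; tri<; tri≈; tri>)
open import Relation.Binary.PropositionalEquality hiding (J)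
open import Data.Nat.Tactic.RingSolver using (solve-∀)

does-true : ∀ {A : Set} (d : Dec A) → does d ≡ true → A
does-true (yes p) _ = p
does-true (no _) ()

T⇒≡true : ∀ {c} → T c → c ≡ true
T⇒≡true {true} _ = refl

≡true⇒T : ∀ {c} → c ≡ true → T c
≡true⇒T refl = tt

¬T⇒≡false : ∀ {c} → ¬ T c → c ≡ false
¬T⇒≡false {true} h = ⊥-elim (h tt)
¬T⇒≡false {false} _ = refl

true≢false : true ≢ false
true≢false ()

bit : Bool → ℕ
bit c = if c then 1 else 0

bit-0 : ∀ {c} → c ≢ true → bit c ≡ 0
bit-0 {true} c≢true = ⊥-elim (c≢true refl)
bit-0 {false} _ = refl

bit-1 : ∀ {c} → bit c ≡ 1 → c ≡ true
bit-1 {true} _ = refl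

bit≤1 : ∀ c → bit c ≤ 1
bit≤1 true = ≤-refl
bit≤1 false = z≤n

bit+bit-not : ∀ c → bit c + bit (not c) ≡ 1
bit+bit-not true = refl
bit+bit-not false = refl

bit-0or1 : ∀ c → bit c ≡ 0 ⊎ bit c ≡ 1
bit-0or1 true = inj₂ refl
bit-0or1 false = inj₁ refl

∨-true : ∀ {c d} → (c ∨ d) ≡ true → c ≡ true ⊎ d ≡ true
∨-true {true} _ = inj₁ refl
∨-true {false} e = inj₂ e

open import Algebra.Properties.CommutativeMonoid.Sum +-0-commutativeMonoid
  using (sum-cong-≗; ∑-distrib-+) renaming (sum to ∑)

∑-mono : ∀ {n} {f g : Fin n → ℕ} → (∀ x → f x ≤ g x) → ∑ f ≤ ∑ g
∑-mono {zero} _ = z≤n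
∑-mono {suc n} f≤g = +-mono-≤ (f≤g zero) (∑-mono (f≤g ∘ suc))

∑-const : ∀ n c → ∑ {n} (λ _ → c) ≡ n * c
∑-const zero c = refl
∑-const (suc n) c = cong (c +_) (∑-const n c)

∑-zero : ∀ n → ∑ {n} (λ _ → 0) ≡ 0
∑-zero n = trans (∑-const n 0) (*-zeroʳ n)

pointMass : ∀ {n} → Fin n → ℕ → Fin n → ℕ
pointMass y X x = if does (x ≟ y) then X else 0

∑-pointMass : ∀ {n} (y : Fin n) X → ∑ (pointMass y X) ≡ X
∑-pointMass {suc n} zero X = trans (cong (X +_) (∑-zero n)) (+-identityʳ X)
∑-pointMass {suc n} (suc y) X = ∑-pointMass y X

pointMass-at : ∀ {n} (y : Fin n) X → pointMass y X y ≡ X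
pointMass-at y X = cong (λ c → if c then X else 0) (dec-true (y ≟ y) refl)

∑-bits : ∀ {N} (T : Subset N) → ∑ (λ v → bit (vlookup T v)) ≡ ∣ T ∣
∑-bits Data.Vec.[] = refl
∑-bits (true Data.Vec.∷ T) = cong suc (∑-bits T)
∑-bits (false Data.Vec.∷ T) = ∑-bits T

∑∑ : ∀ {m H} → (Fin m → Fin H → ℕ) → ℕ
∑∑ f = ∑ (λ k → ∑ (f k))

∑∑-cong : ∀ {m H} {f g : Fin m → Fin H → ℕ} → (∀ k i → f k i ≡ g k i) → ∑∑ f ≡ ∑∑ g
∑∑-cong f≡g = sum-cong-≗ (λ k → sum-cong-≗ (f≡g k))

∑∑-mono : ∀ {m H} {f g : Fin m → Fin H → ℕ} → (∀ k i → f k i ≤ g k i) → ∑∑ f ≤ ∑∑ g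
∑∑-mono f≤g = ∑-mono (λ k → ∑-mono (f≤g k))

∑∑-+ : ∀ {m H} (f g : Fin m → Fin H → ℕ) → ∑∑ (λ k i → f k i + g k i) ≡ ∑∑ f + ∑∑ g
∑∑-+ f g = trans (sum-cong-≗ (λ k → ∑-distrib-+ (f k) (g k))) (∑-distrib-+ (λ k → ∑ (f k)) (λ k → ∑ (g k)))

∑∑-const : ∀ m H c → ∑∑ {m} {H} (λ _ _ → c) ≡ m * (H * c)
∑∑-const m H c = trans (sum-cong-≗ {m} (λ _ → ∑-const H c)) (∑-const m (H * c))

∑∑-zero : ∀ m H → ∑∑ {m} {H} (λ _ _ → 0) ≡ 0
∑∑-zero m H = trans (sum-cong-≗ {m} (λ _ → ∑-zero H)) (∑-zero m)

pointMass₂ : ∀ {m H} → Fin m → Fin H → ℕ → Fin m → Fin H → ℕ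
pointMass₂ k₀ i₀ X k i = if does (k ≟ k₀) then pointMass i₀ X i else 0

∑∑-pointMass₂ : ∀ {m H} (k₀ : Fin m) (i₀ : Fin H) X → ∑∑ (pointMass₂ k₀ i₀ X) ≡ X
∑∑-pointMass₂ {H = H} k₀ i₀ X = trans (sum-cong-≗ row) (∑-pointMass k₀ X)
  where
    row : ∀ k → ∑ (pointMass₂ k₀ i₀ X k) ≡ pointMass k₀ X k
    row k with does (k ≟ k₀)
    ... | true = ∑-pointMass i₀ X
    ... | false = ∑-zero H

pointMass₂-at : ∀ {m H} (k : Fin m) (i : Fin H) X → pointMass₂ k i X k i ≡ X
pointMass₂-at k i X = trans (cong (λ c → if c then pointMass i X i else 0) (dec-true (k ≟ k) refl)) (pointMass-at i X)

mapPair : ∀ {A B : Set} → (A → B) → List A × List A → List B × List B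
mapPair f p = map f (proj₁ p) , map f (proj₂ p)

sum-map-++ : ∀ {A : Set} (f : A → ℕ) xs ys → sum (map f (xs ++ ys)) ≡ sum (map f xs) + sum (map f ys)
sum-map-++ f xs ys = trans (cong sum (map-++ f xs ys)) (sum-++ (map f xs) (map f ys))

sum-map-concatMap : ∀ {A B : Set} (f : B → ℕ) (g : A → List B) xs →
                    sum (map f (concatMap g xs)) ≡ sum (map (λ x → sum (map f (g x))) xs)
sum-map-concatMap f g [] = refl
sum-map-concatMap f g (x ∷ xs) =
  trans (sum-map-++ f (g x) (concatMap g xs)) (cong (sum (map f (g x)) +_) (sum-map-concatMap f g xs))

sum-map-cong : ∀ {A : Set} {f g : A → ℕ} → (∀ x → f x ≡ g x) → ∀ xs → sum (map f xs) ≡ sum (map g xs)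
sum-map-cong f≡g xs = cong sum (Data.List.Properties.map-cong f≡g xs)

sum-map-allFin : ∀ n (f : Fin n → ℕ) → sum (map f (allFin n)) ≡ ∑ f
sum-map-allFin zero f = refl
sum-map-allFin (suc n) f = cong (f zero +_) (begin
    sum (map f (tabulate suc))          ≡⟨ cong sum (map-tabulate suc f) ⟩
    sum (tabulate (f ∘ suc))            ≡⟨ cong sum (map-tabulate (λ x → x) (f ∘ suc)) ⟨
    sum (map (f ∘ suc) (allFin n))      ≡⟨ sum-map-allFin n (f ∘ suc) ⟩
    ∑ (f ∘ suc)                         ∎)
  where open ≡-Reasoning

sum-map-∑∑ : ∀ {A : Set} {m H} (g : A → Fin m → Fin H → ℕ) xs →
             sum (map (λ x → ∑∑ (g x)) xs) ≡ ∑∑ (λ k i → sum (map (λ x → g x k i) xs))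
sum-map-∑∑ {m = m} {H} g [] = sym (∑∑-zero m H)
sum-map-∑∑ g (x ∷ xs) = trans (cong (∑∑ (g x) +_) (sum-map-∑∑ g xs)) (sym (∑∑-+ (g x) _))

length-snoc : ∀ {A : Set} (xs : List A) x → length (xs ++ x ∷ []) ≡ suc (length xs)
length-snoc xs x = trans (length-++ xs) (+-comm (length xs) 1)

length-concatMap-const : ∀ {A B : Set} (f : A → List B) c xs → (∀ x → length (f x) ≡ c) →
                         length (concatMap f xs) ≡ length xs * c
length-concatMap-const f c [] _ = refl
length-concatMap-const f c (x ∷ xs) h = trans (length-++ (f x)) (cong₂ _+_ (h x) (length-concatMap-const f c xs h))

concatMap-[] : ∀ {A B : Set} (g : A → List B) xs → (∀ x → g x ≡ []) → concatMap g xs ≡ []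
concatMap-[] g [] _ = refl
concatMap-[] g (x ∷ xs) g≡[] rewrite g≡[] x = concatMap-[] g xs g≡[]

concatMap-allFin-select : ∀ {A : Set} {N} (g : Fin N → List A) y → (∀ x → x ≢ y → g x ≡ []) →
                          concatMap g (allFin N) ≡ g y
concatMap-allFin-select {N = suc N} g y others = begin
    g zero ++ concatMap g (tabulate suc)          ≡⟨ cong (g zero ++_) shift ⟩
    g zero ++ concatMap (g ∘ suc) (allFin N)      ≡⟨ pick y others ⟩
    g y                                           ∎
  where
    open ≡-Reasoning
    shift : concatMap g (tabulate suc) ≡ concatMap (g ∘ suc) (allFin N)
    shift = cong Data.List.concat (trans (map-tabulate suc g) (sym (map-tabulate (λ x → x) (g ∘ suc))))
    pick : ∀ y → (∀ x → x ≢ y → g x ≡ []) → g zero ++ concatMap (g ∘ suc) (allFin N) ≡ g y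
    pick zero others = trans (cong (g zero ++_) (concatMap-[] (g ∘ suc) (allFin N) (λ x → others (suc x) (λ ())))) (++-identityʳ (g zero))
    pick (suc y) others rewrite others zero (λ ()) =
      concatMap-allFin-select (g ∘ suc) y (λ x x≢y → others (suc x) (λ e → x≢y (Data.Fin.Properties.suc-injective e)))

All-concatMap : ∀ {A B : Set} {P : B → Set} (g : A → List B) xs → (∀ x → All P (g x)) → All P (concatMap g xs)
All-concatMap g [] _ = []
All-concatMap g (x ∷ xs) h = All.++⁺ (h x) (All-concatMap g xs h)

Unique-concatMap : ∀ {A B : Set} (f : A → List B) {xs} → Unique xs → (∀ x → Unique (f x)) →
                   (∀ {x y z} → z ∈ f x → z ∈ f y → x ≡ y) → Unique (concatMap f xs)
Unique-concatMap f {[]} _ _ _ = []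
Unique-concatMap f {x ∷ xs} (x∉xs ∷ u) uf owner = Unique.++⁺ (uf x) (Unique-concatMap f u uf owner) disjoint
  where
    disjoint : Disjoint (f x) (concatMap f xs)
    disjoint (z∈fx , z∈rest) =
      let (y , y∈xs , z∈fy) = find (∈-concatMap⁻ f {xs = xs} z∈rest) in All.lookup x∉xs y∈xs (owner z∈fx z∈fy)

Unique⊆⇒length≤ : ∀ {A : Set} {xs ys : List A} → Unique xs → (∀ {x} → x ∈ xs → x ∈ ys) → length xs ≤ length ys
Unique⊆⇒length≤ {xs = []} _ _ = z≤n
Unique⊆⇒length≤ {xs = x ∷ xs} (x∉xs ∷ u) xs⊆ys with ∈-∃++ (xs⊆ys (here refl))
... | Y₁ , Y₂ , refl = subst (suc (length xs) ≤_) (sym lengthY) (s≤s (Unique⊆⇒length≤ u xs⊆Y))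
  where
    lengthY : length (Y₁ ++ x ∷ Y₂) ≡ suc (length (Y₁ ++ Y₂))
    lengthY = trans (length-++ Y₁) (trans (+-suc (length Y₁) (length Y₂)) (cong suc (sym (length-++ Y₁))))
    xs⊆Y : ∀ {z} → z ∈ xs → z ∈ Y₁ ++ Y₂
    xs⊆Y {z} z∈xs with ∈-++⁻ Y₁ (xs⊆ys (there z∈xs))
    ... | inj₁ q = ∈-++⁺ˡ q
    ... | inj₂ (here z≡x) = ⊥-elim (All.lookup x∉xs z∈xs (sym z≡x))
    ... | inj₂ (there q) = ∈-++⁺ʳ Y₁ q

Unique-before : ∀ {A : Set} (V₁ : List A) u V₂ → Unique (V₁ ++ u ∷ V₂) → ∀ {v} → v ∈ V₁ → v ∉ u ∷ V₂
Unique-before (z ∷ V₁) u V₂ (z∉ ∷ _) (here refl) q = All.lookup z∉ (∈-++⁺ʳ V₁ q) refl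
Unique-before (z ∷ V₁) u V₂ (_ ∷ uniq) (there p) q = Unique-before V₁ u V₂ uniq p q

allFin-split : ∀ {N} (u w : Fin N) → toℕ u < toℕ w →
               Σ[ V₁ ∈ List (Fin N) ] Σ[ V₂ ∈ List (Fin N) ] (allFin N ≡ V₁ ++ u ∷ V₂ × w ∈ V₂)
allFin-split {suc N} zero (suc w) _ =
  [] , tabulate suc , refl , subst (suc w ∈_) (map-tabulate (λ x → x) suc) (∈-map⁺ suc (∈-allFin w))
allFin-split {suc N} (suc u) (suc w) (s≤s u<w) =
  let (V₁ , V₂ , e , w∈V₂) = allFin-split u w u<w in
  zero ∷ map suc V₁ , map suc V₂ ,
  cong (zero ∷_) (trans (sym (map-tabulate (λ x → x) suc)) (trans (cong (map suc) e) (map-++ suc V₁ (u ∷ V₂)))) ,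
  ∈-map⁺ suc w∈V₂

module FirstIndex {A : Set} (_==_ : A → A → Bool)
                  (==-sound : ∀ {x y} → x == y ≡ true → x ≡ y) (==-refl : ∀ x → x == x ≡ true) where

  index : A → List A → ℕ
  index x = indexOf (x ==_)

  ==-false : ∀ {x y} → x ≢ y → x == y ≡ false
  ==-false {x} {y} x≢y with x == y in e
  ... | true = ⊥-elim (x≢y (==-sound e))
  ... | false = refl

  index-at : ∀ x B Z → (∀ {w} → w ∈ B → w ≢ x) → index x (B ++ x ∷ Z) ≡ length B
  index-at x [] Z _ rewrite ==-refl x = refl
  index-at x (z ∷ B) Z notInB rewrite ==-false (λ x≡z → notInB (here refl) (sym x≡z)) =
    cong suc (index-at x B Z (notInB ∘ there))

  index-injective : ∀ {x y} l → x ∈ l → y ∈ l → index x l ≡ index y l → x ≡ y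
  index-injective {x} {y} (z ∷ l) x∈ y∈ e with x == z in ex | y == z in ey
  ... | true | true = trans (==-sound ex) (sym (==-sound ey))
  ... | true | false = ⊥-elim (0≢1+n e)
  ... | false | true = ⊥-elim (0≢1+n (sym e))
  ... | false | false = index-injective l (tail x∈ ex) (tail y∈ ey) (suc-injective e)
    where
      tail : ∀ {w} → w ∈ z ∷ l → w == z ≡ false → w ∈ l
      tail {w} (here refl) e' = ⊥-elim (true≢false (trans (sym (==-refl w)) e'))
      tail (there q) _ = q

  index-< : ∀ x B C → x ∈ B → index x (B ++ C) < length B
  index-< x (z ∷ B) C x∈ with x == z in e
  ... | true = s≤s z≤n
  ... | false with x∈
  ...   | here refl = ⊥-elim (true≢false (trans (sym (==-refl x)) e))
  ...   | there q = s≤s (index-< x B C q)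

  index-≥ : ∀ y B C → (∀ {w} → w ∈ B → w ≢ y) → length B ≤ index y (B ++ C)
  index-≥ y [] C _ = z≤n
  index-≥ y (z ∷ B) C notInB rewrite ==-false (λ y≡z → notInB (here refl) (sym y≡z)) =
    s≤s (index-≥ y B C (notInB ∘ there))

-- The cache content of a single group (one edge e and one index i) under
-- the service of the proof: a slot holding at most one of the six pages of
-- the group.  A strategy s decides which pages the slot takes when they are
-- requested: s = true keeps ā α a b̄ (the “a-side”), s = false keeps
-- ā b β b̄ (the “b-side”).  A block position t is summarised by a Profile,
-- the outcomes of comparing t with 0 and with the positions of the blocks
-- B₁ < B₂ = B₁+1 < B₃ < B₄ = B₃+1 of the group; everything about the block
-- (its requests, the slot before and after it) is a function of the profile,
-- and only eight profiles occur.  Checking those eight (for both strategies)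
-- gives, for every block: the slot moves to its next scheduled content,
-- makes exactly one hit (none in block I), and never exceeds size 2, except
-- by one unit in the two “spare” blocks of the strategy.
module OneGroup where

  kindIndex : Kind → Fin 6
  kindIndex ā = 0F
  kindIndex α = 1F
  kindIndex a = 2F
  kindIndex b = 3F
  kindIndex β = 4F
  kindIndex b̄ = 5F

  kindOf : Fin 6 → Kind
  kindOf 0F = ā
  kindOf 1F = α
  kindOf 2F = a
  kindOf 3F = b
  kindOf 4F = β
  kindOf 5F = b̄

  kindOf-index : ∀ κ → kindOf (kindIndex κ) ≡ κ
  kindOf-index ā = refl
  kindOf-index α = refl
  kindOf-index a = refl
  kindOf-index b = refl
  kindOf-index β = refl
  kindOf-index b̄ = refl

  _≟ₖ_ : DecidableEquality Kind
  κ ≟ₖ κ' = map′ index-injective (cong kindIndex) (kindIndex κ ≟ kindIndex κ')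
    where
      index-injective : kindIndex κ ≡ kindIndex κ' → κ ≡ κ'
      index-injective e = trans (sym (kindOf-index κ)) (trans (cong kindOf e) (kindOf-index κ'))

  Slot : Set
  Slot = Maybe Kind

  holds : Slot → Kind → Bool
  holds nothing _ = false
  holds (just κ') κ = does (κ' ≟ₖ κ)

  holds-just : ∀ {κ' κ} → holds (just κ') κ ≡ true → κ' ≡ κ
  holds-just {κ'} {κ} = does-true (κ' ≟ₖ κ)

  slotSize : Slot → ℕ
  slotSize nothing = 0
  slotSize (just α) = 3
  slotSize (just β) = 3
  slotSize (just _) = 2

  keeps : Bool → Kind → Bool
  keeps s ā = true
  keeps s α = s
  keeps s a = s
  keeps s b = not s
  keeps s β = not s
  keeps s b̄ = true

  serve : Bool → Kind → Slot → Slot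
  serve s κ L = if keeps s κ then just κ else L

  runSlot : Bool → Slot → List Kind → Slot
  runSlot s L [] = L
  runSlot s L (κ ∷ ks) = runSlot s (serve s κ L) ks

  slotHits : Bool → Slot → List Kind → ℕ
  slotHits s L [] = 0
  slotHits s L (κ ∷ ks) = bit (holds L κ) + slotHits s (serve s κ L) ks

  peak : Bool → Slot → List Kind → ℕ
  peak s L [] = slotSize L
  peak s L (κ ∷ ks) = slotSize L ⊔ peak s (serve s κ L) ks

  peak-take : ∀ s L ks j → slotSize (runSlot s L (take j ks)) ≤ peak s L ks
  peak-take s L [] zero = ≤-refl
  peak-take s L [] (suc j) = ≤-refl
  peak-take s L (κ ∷ ks) zero = m≤m⊔n _ _
  peak-take s L (κ ∷ ks) (suc j) = ≤-trans (peak-take s (serve s κ L) ks j) (m≤n⊔m _ _)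

  record Profile : Set where
    constructor profile
    field
      beforeB₁ atB₁ atB₂ beforeB₃ atB₃ atB₄ : Bool
      atI upToB₁ upToB₄ upToB₃ beforeB₄ : Bool
  open Profile

  profileAt : ℕ → ℕ → ℕ → Profile
  profileAt t p₁ p₃ = profile (t <ᵇ p₁) (t ≡ᵇ p₁) (t ≡ᵇ suc p₁) (t <ᵇ p₃) (t ≡ᵇ p₃) (t ≡ᵇ suc p₃)
                              (t ≡ᵇ 0) (t ≤ᵇ p₁) (t ≤ᵇ suc p₃) (t ≤ᵇ p₃) (t <ᵇ suc p₃)

  requestPattern : Profile → List Kind × List Kind
  requestPattern P =
    if beforeB₁ P then (ā ∷ [] , [])
    else if atB₁ P then (ā ∷ α ∷ [] , b ∷ [])
    else if atB₂ P then (α ∷ a ∷ [] , b ∷ [])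
    else if beforeB₃ P then (a ∷ [] , b ∷ [])
    else if atB₃ P then (a ∷ [] , b ∷ β ∷ [])
    else if atB₄ P then (a ∷ [] , β ∷ b̄ ∷ [])
    else ([] , b̄ ∷ [])

  requestsOf : Profile → List Kind
  requestsOf P = proj₁ (requestPattern P) ++ proj₂ (requestPattern P)

  -- the scheduled slot content at the start of a block: empty before I,
  -- ā up to B₁; afterwards α (in B₂), a (up to B₄), b̄ for strategy true,
  -- and b (up to B₃), β (in B₄), b̄ for strategy false
  slotRule : Bool → (start early x y : Bool) → Slot
  slotRule true start early x y =
    if start then nothing else if early then just ā else if x then just α else if y then just a else just b̄
  slotRule false start early x y =
    if start then nothing else if early then just ā else if x then just b else if y then just β else just b̄

  slotBefore slotAfter : Bool → Profile → Slot
  slotBefore true P = slotRule true (atI P) (upToB₁ P) (atB₂ P) (upToB₄ P)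
  slotBefore false P = slotRule false (atI P) (upToB₁ P) (upToB₃ P) (atB₄ P)
  slotAfter true P = slotRule true false (beforeB₁ P) (atB₁ P) (beforeB₄ P)
  slotAfter false P = slotRule false false (beforeB₁ P) (beforeB₃ P) (atB₃ P)

  slotAfter-next : ∀ s t p₁ p₃ → slotAfter s (profileAt t p₁ p₃) ≡ slotBefore s (profileAt (suc t) p₁ p₃)
  slotAfter-next true t p₁ p₃ = refl
  slotAfter-next false t p₁ p₃ = refl

  -- the extra unit of space the group needs inside a block, and at its start
  spare spareAtStart : Bool → Profile → ℕ
  spare true P = bit (atB₁ P ∨ atB₂ P)
  spare false P = bit (atB₃ P ∨ atB₄ P)
  spareAtStart true P = bit (atB₂ P)
  spareAtStart false P = bit (atB₄ P)

  spare-0or1 : ∀ s P → spare s P ≡ 0 ⊎ spare s P ≡ 1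
  spare-0or1 true P = bit-0or1 _
  spare-0or1 false P = bit-0or1 _

  slotBefore-start : ∀ s p₁ p₃ → slotBefore s (profileAt 0 p₁ p₃) ≡ nothing
  slotBefore-start true p₁ p₃ = refl
  slotBefore-start false p₁ p₃ = refl

  spare-start : ∀ s p₁ p₃ → spare s (profileAt 0 (suc p₁) (suc p₃)) ≡ 0
  spare-start true p₁ p₃ = refl
  spare-start false p₁ p₃ = refl

  -- the behaviour of the slot in one block, in a form checkable by evaluation
  record Behaves (s : Bool) (P : Profile) : Set where
    constructor behaving
    field
      runs   : runSlot s (slotBefore s P) (requestsOf P) ≡ slotAfter s P
      hits   : slotHits s (slotBefore s P) (requestsOf P) ≡ (if atI P then 0 else 1)
      peaks  : T (peak s (slotBefore s P) (requestsOf P) ≤ᵇ 2 + spare s P)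
      starts : T (slotSize (slotBefore s P) ≤ᵇ 2 + spareAtStart s P)

  data Region : Set where
    initial early onB₁ onB₂ middle onB₃ onB₄ late : Region

  regionProfile : Region → Profile
  regionProfile initial = profile true  false false true  false false true  true  true  true  true
  regionProfile early   = profile true  false false true  false false false true  true  true  true
  regionProfile onB₁    = profile false true  false true  false false false true  true  true  true
  regionProfile onB₂    = profile false false true  true  false false false false true  true  true
  regionProfile middle  = profile false false false true  false false false false true  true  true
  regionProfile onB₃    = profile false false false false true  false false false true  true  true
  regionProfile onB₄    = profile false false false false false true  false false true  false false
  regionProfile late    = profile false false false false false false false false false false false

  behaves : ∀ s r → Behaves s (regionProfile r)
  behaves true  initial = behaving refl refl tt tt
  behaves true  early   = behaving refl refl tt tt
  behaves true  onB₁    = behaving refl refl tt tt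
  behaves true  onB₂    = behaving refl refl tt tt
  behaves true  middle  = behaving refl refl tt tt
  behaves true  onB₃    = behaving refl refl tt tt
  behaves true  onB₄    = behaving refl refl tt tt
  behaves true  late    = behaving refl refl tt tt
  behaves false initial = behaving refl refl tt tt
  behaves false early   = behaving refl refl tt tt
  behaves false onB₁    = behaving refl refl tt tt
  behaves false onB₂    = behaving refl refl tt tt
  behaves false middle  = behaving refl refl tt tt
  behaves false onB₃    = behaving refl refl tt tt
  behaves false onB₄    = behaving refl refl tt tt
  behaves false late    = behaving refl refl tt tt

  record Cmp (t x : ℕ) (lt eq le : Bool) : Set where
    field
      lt≡ : (t <ᵇ x) ≡ lt
      eq≡ : (t ≡ᵇ x) ≡ eq
      le≡ : (t ≤ᵇ x) ≡ le
  open Cmp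

  below : ∀ {t x} → t < x → Cmp t x true false true
  below {t} {x} t<x = record
    { lt≡ = T⇒≡true (<⇒<ᵇ t<x)
    ; eq≡ = ¬T⇒≡false (λ e → <⇒≢ t<x (≡ᵇ⇒≡ t x e))
    ; le≡ = T⇒≡true (≤⇒≤ᵇ (<⇒≤ t<x)) }

  equal : ∀ {t x} → t ≡ x → Cmp t x false true true
  equal {t} {x} t≡x = record
    { lt≡ = ¬T⇒≡false (λ e → <⇒≢ (<ᵇ⇒< t x e) t≡x)
    ; eq≡ = T⇒≡true (≡⇒≡ᵇ t x t≡x)
    ; le≡ = T⇒≡true (≤⇒≤ᵇ (≤-reflexive t≡x)) }

  above : ∀ {t x} → x < t → Cmp t x false false false
  above {t} {x} x<t = record
    { lt≡ = ¬T⇒≡false (λ e → <-asym x<t (<ᵇ⇒< t x e))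
    ; eq≡ = ¬T⇒≡false (λ e → >⇒≢ x<t (≡ᵇ⇒≡ t x e))
    ; le≡ = ¬T⇒≡false (λ e → <⇒≱ x<t (≤ᵇ⇒≤ t x e)) }

  profileFromCmp : ∀ {t p₁ p₃ b₀ c₀ d₀ b₁ c₁ d₁ b₂ c₂ d₂ b₃ c₃ d₃ b₄ c₄ d₄} →
                   Cmp t 0 b₀ c₀ d₀ → Cmp t p₁ b₁ c₁ d₁ → Cmp t (suc p₁) b₂ c₂ d₂ →
                   Cmp t p₃ b₃ c₃ d₃ → Cmp t (suc p₃) b₄ c₄ d₄ →
                   profileAt t p₁ p₃ ≡ profile b₁ c₁ c₂ b₃ c₃ c₄ c₀ d₁ d₄ d₃ b₄
  profileFromCmp q₀ q₁ q₂ q₃ q₄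
    rewrite lt≡ q₁ | eq≡ q₁ | eq≡ q₂ | lt≡ q₃ | eq≡ q₃ | eq≡ q₄ | eq≡ q₀ | le≡ q₁ | le≡ q₄ | le≡ q₃ | lt≡ q₄
    = refl

  classify : ∀ {p₁ p₃} → 1 ≤ p₁ → suc p₁ < p₃ → ∀ t → Σ Region (λ r → profileAt t p₁ p₃ ≡ regionProfile r)
  classify {p₁} {p₃} 1≤p₁ p₂<p₃ t with <-cmp t p₁
  ... | tri< t<p₁ _ _ = beforeB₁' t t<p₁
    where
      beforeP₃ : ∀ {u} → u < p₁ → Cmp u p₃ true false true × Cmp u (suc p₃) true false true
      beforeP₃ u<p₁ = let u<p₃ = <-trans (<-trans u<p₁ (n<1+n p₁)) p₂<p₃
                      in below u<p₃ , below (<-trans u<p₃ (n<1+n p₃))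
      beforeB₁' : ∀ u → u < p₁ → Σ Region (λ r → profileAt u p₁ p₃ ≡ regionProfile r)
      beforeB₁' zero u<p₁ = initial , profileFromCmp (equal refl) (below u<p₁)
        (below (<-trans u<p₁ (n<1+n p₁))) (proj₁ (beforeP₃ u<p₁)) (proj₂ (beforeP₃ u<p₁))
      beforeB₁' (suc u) u<p₁ = early , profileFromCmp (above (s≤s z≤n)) (below u<p₁)
        (below (<-trans u<p₁ (n<1+n p₁))) (proj₁ (beforeP₃ u<p₁)) (proj₂ (beforeP₃ u<p₁))
  ... | tri≈ _ t≡p₁ _ = onB₁ , profileFromCmp (above (≤-trans 1≤p₁ (≤-reflexive (sym t≡p₁)))) (equal t≡p₁)
        (below (≤-reflexive (cong suc t≡p₁))) (below t<p₃) (below (<-trans t<p₃ (n<1+n p₃)))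
    where t<p₃ = <-trans (≤-reflexive (cong suc t≡p₁)) p₂<p₃
  ... | tri> _ _ p₁<t with <-cmp t (suc p₁)
  ...   | tri< t<p₂ _ _ = ⊥-elim (<-irrefl refl (<-≤-trans p₁<t (≤-pred t<p₂)))
  ...   | tri≈ _ t≡p₂ _ = onB₂ , profileFromCmp (above (≤-trans 1≤p₁ (<⇒≤ p₁<t))) (above p₁<t) (equal t≡p₂)
        (below t<p₃) (below (<-trans t<p₃ (n<1+n p₃)))
    where t<p₃ = ≤-trans (≤-reflexive (cong suc t≡p₂)) p₂<p₃
  ...   | tri> _ _ p₂<t with <-cmp t p₃
  ...     | tri< t<p₃ _ _ = middle , profileFromCmp (above (≤-trans 1≤p₁ (<⇒≤ p₁<t))) (above p₁<t) (above p₂<t)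
        (below t<p₃) (below (<-trans t<p₃ (n<1+n p₃)))
  ...     | tri≈ _ t≡p₃ _ = onB₃ , profileFromCmp (above (≤-trans 1≤p₁ (<⇒≤ p₁<t))) (above p₁<t) (above p₂<t)
        (equal t≡p₃) (below (≤-reflexive (cong suc t≡p₃)))
  ...     | tri> _ _ p₃<t with <-cmp t (suc p₃)
  ...       | tri< t<p₄ _ _ = ⊥-elim (<-irrefl refl (<-≤-trans p₃<t (≤-pred t<p₄)))
  ...       | tri≈ _ t≡p₄ _ = onB₄ , profileFromCmp (above (≤-trans 1≤p₁ (<⇒≤ p₁<t))) (above p₁<t) (above p₂<t)
        (above p₃<t) (equal t≡p₄)
  ...       | tri> _ _ p₄<t = late , profileFromCmp (above (≤-trans 1≤p₁ (<⇒≤ p₁<t))) (above p₁<t) (above p₂<t)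
        (above p₃<t) (above p₄<t)

  record BlockFacts (s : Bool) (P : Profile) : Set where
    field
      runs   : runSlot s (slotBefore s P) (requestsOf P) ≡ slotAfter s P
      hits   : slotHits s (slotBefore s P) (requestsOf P) ≡ (if atI P then 0 else 1)
      peaks  : ∀ j → slotSize (runSlot s (slotBefore s P) (take j (requestsOf P))) ≤ 2 + spare s P
      starts : slotSize (slotBefore s P) ≤ 2 + spareAtStart s P

  blockFacts : ∀ {p₁ p₃} → 1 ≤ p₁ → suc p₁ < p₃ → ∀ s t → BlockFacts s (profileAt t p₁ p₃)
  blockFacts {p₁} {p₃} 1≤p₁ p₂<p₃ s t =
    subst (BlockFacts s) (sym (proj₂ region)) (fromBehaves (behaves s (proj₁ region)))
    where
      region = classify 1≤p₁ p₂<p₃ t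
      fromBehaves : ∀ {P} → Behaves s P → BlockFacts s P
      fromBehaves (behaving r h p st) = record
        { runs = r ; hits = h
        ; peaks = λ j → ≤-trans (peak-take s _ _ j) (≤ᵇ⇒≤ _ _ p)
        ; starts = ≤ᵇ⇒≤ _ _ st }

-- Any deterministic simulation of a cache yields a service, provided its
-- cache content fits after every prefix of the requests and only ever
-- gains the page just requested; its savings are the costs of its hits.
module ServiceFromSimulation {P : Set} (allP : List P) (size cost : P → ℕ) (Cap : ℕ) (rs : List P)
    {State : Set} (cached : State → P → Bool) (step : P → State → State)
    (gainsOnlyRequested : ∀ σ r p → cached (step r σ) p ≡ true → cached σ p ≡ true ⊎ p ≡ r) where

  open Caching allP size cost Cap rs

  run : State → List P → State
  run σ [] = σ
  run σ (r ∷ l) = run (step r σ) l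

  run-++ : ∀ σ l₁ l₂ → run σ (l₁ ++ l₂) ≡ run (run σ l₁) l₂
  run-++ σ [] l₂ = refl
  run-++ σ (r ∷ l₁) l₂ = run-++ (step r σ) l₁ l₂

  saved paid : State → List P → ℕ
  saved σ [] = 0
  saved σ (r ∷ l) = (if cached σ r then cost r else 0) + saved (step r σ) l
  paid σ [] = 0
  paid σ (r ∷ l) = (if cached σ r then 0 else cost r) + paid (step r σ) l

  saved-++ : ∀ σ l₁ l₂ → saved σ (l₁ ++ l₂) ≡ saved σ l₁ + saved (run σ l₁) l₂
  saved-++ σ [] l₂ = refl
  saved-++ σ (r ∷ l₁) l₂ =
    trans (cong (h +_) (saved-++ (step r σ) l₁ l₂)) (sym (+-assoc h (saved (step r σ) l₁) _))
    where h = if cached σ r then cost r else 0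

  saved+paid : ∀ σ l → saved σ l + paid σ l ≡ sum (map cost l)
  saved+paid σ [] = refl
  saved+paid σ (r ∷ l) with cached σ r
  ... | true = trans (+-assoc (cost r) _ _) (cong (cost r +_) (saved+paid (step r σ) l))
  ... | false = begin
      saved σ' l + (cost r + paid σ' l)   ≡⟨ +-comm (saved σ' l) _ ⟩
      (cost r + paid σ' l) + saved σ' l   ≡⟨ +-assoc (cost r) _ _ ⟩
      cost r + (paid σ' l + saved σ' l)   ≡⟨ cong (cost r +_) (+-comm (paid σ' l) _) ⟩
      cost r + (saved σ' l + paid σ' l)   ≡⟨ cong (cost r +_) (saved+paid σ' l) ⟩
      cost r + sum (map cost l)           ∎
    where
      open ≡-Reasoning
      σ' = step r σ

  Fits : State → Set
  Fits σ = totalSize (cached σ) ≤ Cap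

  FitsAlong : State → List P → Set
  FitsAlong σ [] = Fits σ
  FitsAlong σ (r ∷ l) = Fits σ × FitsAlong (step r σ) l

  FitsAlong-++ : ∀ σ l₁ l₂ → FitsAlong σ l₁ → FitsAlong (run σ l₁) l₂ → FitsAlong σ (l₁ ++ l₂)
  FitsAlong-++ σ [] l₂ _ f₂ = f₂
  FitsAlong-++ σ (r ∷ l₁) l₂ (f , f₁) f₂ = f , FitsAlong-++ (step r σ) l₁ l₂ f₁ f₂

  FitsAlong-last : ∀ σ l → FitsAlong σ l → Fits (run σ l)
  FitsAlong-last σ [] f = f
  FitsAlong-last σ (r ∷ l) (_ , f) = FitsAlong-last (step r σ) l f

  FitsAlong-prefixes : ∀ σ l → (∀ j → Fits (run σ (take j l))) → FitsAlong σ l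
  FitsAlong-prefixes σ [] f = f 0
  FitsAlong-prefixes σ (r ∷ l) f = f 0 , FitsAlong-prefixes (step r σ) l (f ∘ suc)

  -- the state just before request t (the final state for t = length l)
  stateAt : State → List P → ℕ → State
  stateAt σ l zero = σ
  stateAt σ [] (suc t) = σ
  stateAt σ (r ∷ l) (suc t) = stateAt (step r σ) l t

  serviceCost-shift : ∀ (st : ℕ → Cache) t l → serviceCostFrom st (suc t) l ≡ serviceCostFrom (st ∘ suc) t l
  serviceCost-shift st t [] = refl
  serviceCost-shift st t (r ∷ l) = cong (_ +_) (serviceCost-shift st (suc t) l)

  serviceCost-stateAt : ∀ σ l → serviceCostFrom (λ t → cached (stateAt σ l t)) 0 l ≡ paid σ l
  serviceCost-stateAt σ [] = refl
  serviceCost-stateAt σ (r ∷ l) = cong (_ +_)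
    (trans (serviceCost-shift (λ t → cached (stateAt σ (r ∷ l) t)) 0 l) (serviceCost-stateAt (step r σ) l))

  gains-stateAt : ∀ σ l t (h : t < length l) p → cached (stateAt σ l (suc t)) p ≡ true →
                  cached (stateAt σ l t) p ≡ true ⊎ p ≡ lookup l (fromℕ< h)
  gains-stateAt σ (r ∷ l) zero h p = gainsOnlyRequested σ r p
  gains-stateAt σ (r ∷ l) (suc t) (s≤s h) p = gains-stateAt (step r σ) l t h p

  fits-stateAt : ∀ σ l → FitsAlong σ l → ∀ t → t ≤ length l → Fits (stateAt σ l t)
  fits-stateAt σ [] f zero _ = f
  fits-stateAt σ (r ∷ l) (f , _) zero _ = f
  fits-stateAt σ (r ∷ l) (_ , f) (suc t) (s≤s h) = fits-stateAt (step r σ) l f t h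

  service : ∀ σ₀ → (∀ p → cached σ₀ p ≡ false) → FitsAlong σ₀ rs → Σ Service (λ s → savings s ≡ saved σ₀ rs)
  service σ₀ empty fits = sv , savings-sv
    where
      sv : Service
      sv = record
        { state = λ t → cached (stateAt σ₀ rs t)
        ; startsEmpty = empty
        ; onlyLoadsRequested = gains-stateAt σ₀ rs
        ; fits = fits-stateAt σ₀ rs fits }
      savings-sv : savings sv ≡ saved σ₀ rs
      savings-sv = begin
          sum (map cost rs) ∸ serviceCostFrom (λ t → cached (stateAt σ₀ rs t)) 0 rs
        ≡⟨ cong₂ _∸_ (sym (saved+paid σ₀ rs)) (serviceCost-stateAt σ₀ rs) ⟩
          (saved σ₀ rs + paid σ₀ rs) ∸ paid σ₀ rs
        ≡⟨ m+n∸n≡m (saved σ₀ rs) (paid σ₀ rs) ⟩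
          saved σ₀ rs
        ∎ where open ≡-Reasoning

-- The block structure of the instance: every group (k , i) has its blocks
-- B₁ B₂ adjacent in the phase of the first endpoint of edge k and B₃ B₄
-- adjacent in the phase of the second, so their positions satisfy
-- 1 ≤ P₁,  P₂ = P₁ + 1 < P₃,  P₄ = P₃ + 1.
module Blocks {n m : ℕ} (G : Graph n m) (O : IncidenceOrder G) (H : ℕ) where
  open Graph G
  open IncidenceOrder O
  open Instance G O H
  open OneGroup using (Profile; profile; profileAt; requestPattern; spare; spareAtStart)

  BN : Set
  BN = BName m H

  -- the endpoint of edge k whose phase comes second
  highEnd : Fin m → Fin n
  highEnd k = if toℕ (proj₁ (edge k)) ≤ᵇ toℕ (proj₂ (edge k)) then proj₂ (edge k) else proj₁ (edge k)

  Endpoints : Fin m → Set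
  Endpoints k = (lowEnd k ≡ proj₁ (edge k) × highEnd k ≡ proj₂ (edge k))
              ⊎ (lowEnd k ≡ proj₂ (edge k) × highEnd k ≡ proj₁ (edge k))

  endpoints : ∀ k → Endpoints k × toℕ (lowEnd k) < toℕ (highEnd k)
  endpoints k with toℕ (proj₁ (edge k)) ≤ᵇ toℕ (proj₂ (edge k)) in eq
  ... | true = inj₁ (refl , refl) , ≤∧≢⇒< (≤ᵇ⇒≤ _ _ (≡true⇒T eq)) (λ e → loopless k (toℕ-injective e))
  ... | false = inj₂ (refl , refl) , ≰⇒> (λ le → true≢false (trans (sym (T⇒≡true (≤⇒≤ᵇ le))) eq))

  lowEnd<highEnd : ∀ k → toℕ (lowEnd k) < toℕ (highEnd k)
  lowEnd<highEnd k = proj₂ (endpoints k)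

  highEnd≢lowEnd : ∀ k → highEnd k ≢ lowEnd k
  highEnd≢lowEnd k e = <-irrefl (cong toℕ (sym e)) (lowEnd<highEnd k)

  lowEnd-incident : ∀ k → IncidentTo (lowEnd k) k
  lowEnd-incident k with proj₁ (endpoints k)
  ... | inj₁ (e , _) = inj₁ (sym e)
  ... | inj₂ (e , _) = inj₂ (sym e)

  highEnd-incident : ∀ k → IncidentTo (highEnd k) k
  highEnd-incident k with proj₁ (endpoints k)
  ... | inj₁ (_ , e) = inj₂ (sym e)
  ... | inj₂ (_ , e) = inj₁ (sym e)

  incident⇒highEnd : ∀ k v → IncidentTo v k → v ≢ lowEnd k → v ≡ highEnd k
  incident⇒highEnd k v v-k v≢low with proj₁ (endpoints k) | v-k
  ... | inj₁ (l , _) | inj₁ e = ⊥-elim (v≢low (trans (sym e) (sym l)))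
  ... | inj₁ (_ , h) | inj₂ e = trans (sym e) (sym h)
  ... | inj₂ (_ , h) | inj₁ e = trans (sym e) (sym h)
  ... | inj₂ (l , _) | inj₂ e = ⊥-elim (v≢low (trans (sym e) (sym l)))

  independent-ends : ∀ {S : Subset n} → IndependentSet S → ∀ k →
                     lowEnd k Data.Fin.Subset.∈ S → highEnd k Data.Fin.Subset.∈ S → ⊥
  independent-ends indep k low∈ high∈ with proj₁ (endpoints k)
  ... | inj₁ (l , h) = indep k (subst (Data.Fin.Subset._∈ _) l low∈ , subst (Data.Fin.Subset._∈ _) h high∈)
  ... | inj₂ (l , h) = indep k (subst (Data.Fin.Subset._∈ _) h high∈ , subst (Data.Fin.Subset._∈ _) l low∈)

  eqJ-sound : ∀ j j' → eqJ j j' ≡ true → j ≡ j'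
  eqJ-sound j1 j1 _ = refl
  eqJ-sound j2 j2 _ = refl
  eqJ-sound j3 j3 _ = refl
  eqJ-sound j4 j4 _ = refl
  eqJ-sound j1 j2 ()
  eqJ-sound j1 j3 ()
  eqJ-sound j1 j4 ()
  eqJ-sound j2 j1 ()
  eqJ-sound j2 j3 ()
  eqJ-sound j2 j4 ()
  eqJ-sound j3 j1 ()
  eqJ-sound j3 j2 ()
  eqJ-sound j3 j4 ()
  eqJ-sound j4 j1 ()
  eqJ-sound j4 j2 ()
  eqJ-sound j4 j3 ()

  eqJ-refl : ∀ j → eqJ j j ≡ true
  eqJ-refl j1 = refl
  eqJ-refl j2 = refl
  eqJ-refl j3 = refl
  eqJ-refl j4 = refl

  eqB-sound : ∀ {x y : BN} → eqB x y ≡ true → x ≡ y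
  eqB-sound {bI} {bI} _ = refl
  eqB-sound {bF} {bF} _ = refl
  eqB-sound {bI} {bF} ()
  eqB-sound {bI} {blk _ _ _} ()
  eqB-sound {bF} {bI} ()
  eqB-sound {bF} {blk _ _ _} ()
  eqB-sound {blk _ _ _} {bI} ()
  eqB-sound {blk _ _ _} {bF} ()
  eqB-sound {blk k i j} {blk k' i' j'} e with k ≟ k' | i ≟ i'
  ... | yes refl | yes refl = cong (blk k i) (eqJ-sound j j' e)
  eqB-sound {blk k i j} {blk k' i' j'} () | yes refl | no _
  eqB-sound {blk k i j} {blk k' i' j'} () | no _ | _

  eqB-refl : ∀ (x : BN) → eqB x x ≡ true
  eqB-refl bI = refl
  eqB-refl bF = refl
  eqB-refl (blk k i j) with k ≟ k | i ≟ i
  ... | yes _ | yes _ = eqJ-refl j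
  ... | yes _ | no i≢i = ⊥-elim (i≢i refl)
  ... | no k≢k | _ = ⊥-elim (k≢k refl)

  open FirstIndex eqB eqB-sound eqB-refl

  blk-injective : ∀ {k k' i i' j j'} → blk {m} {H} k i j ≡ blk k' i' j' → (k ≡ k') × (i ≡ i') × (j ≡ j')
  blk-injective refl = refl , refl , refl

  -- the vertex in whose phase the block blk k i j lies
  owner : Fin m → J → Fin n
  owner k j1 = lowEnd k
  owner k j2 = lowEnd k
  owner k j3 = highEnd k
  owner k j4 = highEnd k

  owner-incident : ∀ k j → k ∈ inc (owner k j)
  owner-incident k j1 = proj₂ (complete _ k) (lowEnd-incident k)
  owner-incident k j2 = proj₂ (complete _ k) (lowEnd-incident k)
  owner-incident k j3 = proj₂ (complete _ k) (highEnd-incident k)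
  owner-incident k j4 = proj₂ (complete _ k) (highEnd-incident k)

  pairBlocks : Fin n → Fin m → Fin H → List BN
  pairBlocks v k i = if ⌊ v ≟ lowEnd k ⌋ then blk k i j1 ∷ blk k i j2 ∷ [] else blk k i j3 ∷ blk k i j4 ∷ []

  edgeBlocks : Fin n → Fin m → List BN
  edgeBlocks v k = concatMap (pairBlocks v k) (allFin H)

  pairBlocks-low : ∀ k i → pairBlocks (lowEnd k) k i ≡ blk k i j1 ∷ blk k i j2 ∷ []
  pairBlocks-low k i with lowEnd k ≟ lowEnd k
  ... | yes _ = refl
  ... | no low≢low = ⊥-elim (low≢low refl)

  pairBlocks-high : ∀ k i → pairBlocks (highEnd k) k i ≡ blk k i j3 ∷ blk k i j4 ∷ []
  pairBlocks-high k i with highEnd k ≟ lowEnd k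
  ... | yes e = ⊥-elim (highEnd≢lowEnd k e)
  ... | no _ = refl

  pairBlocks-named : ∀ v k i x → x ∈ pairBlocks v k i → Σ J (λ j → x ≡ blk k i j × (k ∈ inc v → v ≡ owner k j))
  pairBlocks-named v k i x q with v ≟ lowEnd k
  pairBlocks-named v k i x (here e) | yes v≡ = j1 , e , λ _ → v≡
  pairBlocks-named v k i x (there (here e)) | yes v≡ = j2 , e , λ _ → v≡
  pairBlocks-named v k i x (here e) | no v≢ = j3 , e , λ k∈ → incident⇒highEnd k v (proj₁ (complete v k) k∈) v≢
  pairBlocks-named v k i x (there (here e)) | no v≢ = j4 , e , λ k∈ → incident⇒highEnd k v (proj₁ (complete v k) k∈) v≢

  record PhaseMember (v : Fin n) (x : BN) : Set where
    constructor member
    field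
      edgeOf : Fin m
      groupOf : Fin H
      blockOf : J
      named : x ≡ blk edgeOf groupOf blockOf
      owned : v ≡ owner edgeOf blockOf

  edgeBlocks-named : ∀ v k x → x ∈ edgeBlocks v k → Σ (Fin H) (λ i → Σ J (λ j → x ≡ blk k i j × (k ∈ inc v → v ≡ owner k j)))
  edgeBlocks-named v k x q =
    let (i , _ , q₁) = find (∈-concatMap⁻ (pairBlocks v k) {xs = allFin H} q) in i , pairBlocks-named v k i x q₁

  phaseMember : ∀ v x → x ∈ phaseBlocks v → PhaseMember v x
  phaseMember v x q =
    let (k , k∈ , q₁) = find (∈-concatMap⁻ (edgeBlocks v) {xs = inc v} q)
        (i , j , e , owned) = edgeBlocks-named v k x q₁
    in member k i j e (owned k∈)

  inOwnPair : ∀ k i j → blk k i j ∈ pairBlocks (owner k j) k i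
  inOwnPair k i j1 = subst (blk k i j1 ∈_) (sym (pairBlocks-low k i)) (here refl)
  inOwnPair k i j2 = subst (blk k i j2 ∈_) (sym (pairBlocks-low k i)) (there (here refl))
  inOwnPair k i j3 = subst (blk k i j3 ∈_) (sym (pairBlocks-high k i)) (here refl)
  inOwnPair k i j4 = subst (blk k i j4 ∈_) (sym (pairBlocks-high k i)) (there (here refl))

  inPhase : ∀ k i j → blk k i j ∈ phaseBlocks (owner k j)
  inPhase k i j = ∈-concatMap⁺ (edgeBlocks (owner k j)) (lose (owner-incident k j)
                    (∈-concatMap⁺ (pairBlocks (owner k j) k) (lose (∈-allFin i) (inOwnPair k i j))))

  phaseList : List BN
  phaseList = concatMap phaseBlocks (allFin n)

  inPhaseList : ∀ {v x} → x ∈ phaseBlocks v → x ∈ phaseList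
  inPhaseList q = ∈-concatMap⁺ phaseBlocks (lose (∈-allFin _) q)

  inBlockNames : ∀ {v x} → x ∈ phaseBlocks v → x ∈ blockNames
  inBlockNames q = there (∈-++⁺ˡ (inPhaseList q))

  phaseList-member : ∀ {x} → x ∈ phaseList → Σ (Fin n) (λ v → PhaseMember v x)
  phaseList-member q = let (v , _ , q₁) = find (∈-concatMap⁻ phaseBlocks {xs = allFin n} q) in v , phaseMember v _ q₁

  phase-unique-owner : ∀ {v v' x} → x ∈ phaseBlocks v → x ∈ phaseBlocks v' → v ≡ v'
  phase-unique-owner {v} {v'} {x} q q' with phaseMember v x q | phaseMember v' x q'
  ... | member k i j e owned | member k' i' j' e' owned' with blk-injective (trans (sym e) e')
  ... | refl , refl , refl = trans owned (sym owned')

  bI≢blk : ∀ {k i j} → bI {m} {H} ≢ blk k i j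
  bI≢blk ()

  bF≢blk : ∀ {k i j} → bF {m} {H} ≢ blk k i j
  bF≢blk ()

  Unique-pairBlocks : ∀ v k i → Unique (pairBlocks v k i)
  Unique-pairBlocks v k i with ⌊ v ≟ lowEnd k ⌋
  ... | true = ((λ ()) ∷ []) ∷ [] ∷ []
  ... | false = ((λ ()) ∷ []) ∷ [] ∷ []

  Unique-edgeBlocks : ∀ v k → Unique (edgeBlocks v k)
  Unique-edgeBlocks v k = Unique-concatMap (pairBlocks v k) (Unique.allFin⁺ H) (Unique-pairBlocks v k)
    (λ {i} {i'} {z} q q' → let (_ , e , _) = pairBlocks-named v k i z q ; (_ , e' , _) = pairBlocks-named v k i' z q'
                           in proj₁ (proj₂ (blk-injective (trans (sym e) e'))))

  Unique-phaseBlocks : ∀ v → Unique (phaseBlocks v)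
  Unique-phaseBlocks v = Unique-concatMap (edgeBlocks v) (unique v) (Unique-edgeBlocks v)
    (λ {k} {k'} {z} q q' → let (_ , _ , e , _) = edgeBlocks-named v k z q ; (_ , _ , e' , _) = edgeBlocks-named v k' z q'
                           in proj₁ (blk-injective (trans (sym e) e')))

  Unique-blockNames : Unique blockNames
  Unique-blockNames = All.tabulate notI ∷ Unique.++⁺ Unique-phaseList ([] ∷ []) notF
    where
      Unique-phaseList : Unique phaseList
      Unique-phaseList = Unique-concatMap phaseBlocks (Unique.allFin⁺ n) Unique-phaseBlocks phase-unique-owner
      notI : ∀ {x} → x ∈ phaseList ++ bF ∷ [] → bI ≢ x
      notI q e with ∈-++⁻ phaseList q
      ... | inj₁ q₁ = bI≢blk (trans e (PhaseMember.named (proj₂ (phaseList-member q₁))))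
      notI q () | inj₂ (here refl)
      notF : Disjoint phaseList (bF ∷ [])
      notF (q , here refl) = bF≢blk (PhaseMember.named (proj₂ (phaseList-member q)))

  pos-at : ∀ x A Z → blockNames ≡ A ++ x ∷ Z → pos x ≡ length A
  pos-at x A Z e = trans (cong (index x) e) (index-at x A Z (notBefore A (subst Unique e Unique-blockNames)))
    where
      notBefore : ∀ A → Unique (A ++ x ∷ Z) → ∀ {w} → w ∈ A → w ≢ x
      notBefore (z ∷ A) (z∉ ∷ _) (here refl) = All.lookup z∉ (∈-++⁺ʳ A (here refl))
      notBefore (z ∷ A) (_ ∷ uniq) (there q) = notBefore A uniq q

  pos-injective : ∀ {x y} → x ∈ blockNames → y ∈ blockNames → pos x ≡ pos y → x ≡ y
  pos-injective = index-injective blockNames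

  Adjacent : BN → BN → List BN → Set
  Adjacent x y l = Σ[ A ∈ List BN ] Σ[ Z ∈ List BN ] l ≡ A ++ x ∷ y ∷ Z

  adjacent-++ˡ : ∀ {x y} l₀ l → Adjacent x y l → Adjacent x y (l₀ ++ l)
  adjacent-++ˡ {x} {y} l₀ l (A , Z , e) = l₀ ++ A , Z , trans (cong (l₀ ++_) e) (sym (++-assoc l₀ A (x ∷ y ∷ Z)))

  adjacent-++ʳ : ∀ {x y} l l₂ → Adjacent x y l → Adjacent x y (l ++ l₂)
  adjacent-++ʳ {x} {y} l l₂ (A , Z , e) = A , Z ++ l₂ , trans (cong (_++ l₂) e) (++-assoc A (x ∷ y ∷ Z) l₂)

  adjacent-concatMap : ∀ {C : Set} {x y} (f : C → List BN) {c} cs → c ∈ cs → Adjacent x y (f c) →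
                       Adjacent x y (concatMap f cs)
  adjacent-concatMap f (c ∷ cs) (here refl) adj = adjacent-++ʳ (f c) (concatMap f cs) adj
  adjacent-concatMap f (c' ∷ cs) (there q) adj = adjacent-++ˡ (f c') (concatMap f cs) (adjacent-concatMap f cs q adj)

  adjacent⇒pos : ∀ {x y} → Adjacent x y blockNames → pos y ≡ suc (pos x)
  adjacent⇒pos {x} {y} (A , Z , e) = begin
      pos y               ≡⟨ pos-at y (A ++ x ∷ []) Z (trans e (sym (++-assoc A (x ∷ []) (y ∷ Z)))) ⟩
      length (A ++ x ∷ [])  ≡⟨ length-snoc A x ⟩
      suc (length A)      ≡⟨ cong suc (pos-at x A (y ∷ Z) e) ⟨
      suc (pos x)         ∎
    where open ≡-Reasoning

  adjacentInPair : ∀ {x y} k i j → Adjacent x y (pairBlocks (owner k j) k i) → Adjacent x y blockNames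
  adjacentInPair k i j adj = adjacent-++ˡ (bI ∷ []) _ (adjacent-++ʳ _ (bF ∷ [])
    (adjacent-concatMap phaseBlocks (allFin n) (∈-allFin (owner k j))
      (adjacent-concatMap (edgeBlocks (owner k j)) (inc (owner k j)) (owner-incident k j)
        (adjacent-concatMap (pairBlocks (owner k j) k) (allFin H) (∈-allFin i) adj))))

  phase-order : ∀ {u w x y} → toℕ u < toℕ w → x ∈ phaseBlocks u → y ∈ phaseBlocks w → pos x < pos y
  phase-order {u} {w} {x} {y} u<w x∈ y∈ =
    <-≤-trans (subst (λ l → index x l < length A) (sym split) (index-< x A B x∈A))
              (subst (λ l → length A ≤ index y l) (sym split) (index-≥ y A B y∉A))
    where
      parts = allFin-split u w u<w
      V₁ = proj₁ parts
      V₂ = proj₁ (proj₂ parts)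
      allFin≡ = proj₁ (proj₂ (proj₂ parts))
      w∈V₂ = proj₂ (proj₂ (proj₂ parts))
      A B : List BN
      A = bI ∷ concatMap phaseBlocks (V₁ ++ u ∷ [])
      B = concatMap phaseBlocks V₂ ++ bF ∷ []
      split : blockNames ≡ A ++ B
      split = cong (bI ∷_) (begin
          concatMap phaseBlocks (allFin n) ++ bF ∷ []
        ≡⟨ cong (λ l → concatMap phaseBlocks l ++ bF ∷ []) (trans allFin≡ (sym (++-assoc V₁ (u ∷ []) V₂))) ⟩
          concatMap phaseBlocks ((V₁ ++ u ∷ []) ++ V₂) ++ bF ∷ []
        ≡⟨ cong (_++ bF ∷ []) (concatMap-++ phaseBlocks (V₁ ++ u ∷ []) V₂) ⟩
          (concatMap phaseBlocks (V₁ ++ u ∷ []) ++ concatMap phaseBlocks V₂) ++ bF ∷ []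
        ≡⟨ ++-assoc (concatMap phaseBlocks (V₁ ++ u ∷ [])) _ _ ⟩
          concatMap phaseBlocks (V₁ ++ u ∷ []) ++ B
        ∎)
        where open ≡-Reasoning
      x∈A : x ∈ A
      x∈A = there (∈-concatMap⁺ phaseBlocks (lose (∈-++⁺ʳ V₁ (here refl)) x∈))
      w∉ : w ∈ V₁ ++ u ∷ [] → ⊥
      w∉ q with ∈-++⁻ V₁ q
      ... | inj₁ w∈V₁ = Unique-before V₁ u V₂ (subst Unique allFin≡ (Unique.allFin⁺ n)) w∈V₁ (there w∈V₂)
      ... | inj₂ (here w≡u) = <-irrefl (cong toℕ (sym w≡u)) u<w
      y∉A : ∀ {z} → z ∈ A → z ≢ y
      y∉A (here refl) bI≡y = bI≢blk (trans bI≡y (PhaseMember.named (phaseMember w y y∈)))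
      y∉A (there q) refl =
        let (v , v∈ , q₁) = find (∈-concatMap⁻ phaseBlocks {xs = V₁ ++ u ∷ []} q)
        in w∉ (subst (_∈ V₁ ++ u ∷ []) (phase-unique-owner q₁ y∈) v∈)

  P₁ P₂ P₃ P₄ : Fin m → Fin H → ℕ
  P₁ k i = pos (blk k i j1)
  P₂ k i = pos (blk k i j2)
  P₃ k i = pos (blk k i j3)
  P₄ k i = pos (blk k i j4)

  1≤P₁ : ∀ k i → 1 ≤ P₁ k i
  1≤P₁ k i = s≤s z≤n

  P₂≡ : ∀ k i → P₂ k i ≡ suc (P₁ k i)
  P₂≡ k i = adjacent⇒pos (adjacentInPair k i j1 ([] , [] , pairBlocks-low k i))

  P₄≡ : ∀ k i → P₄ k i ≡ suc (P₃ k i)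
  P₄≡ k i = adjacent⇒pos (adjacentInPair k i j3 ([] , [] , pairBlocks-high k i))

  P₂<P₃ : ∀ k i → suc (P₁ k i) < P₃ k i
  P₂<P₃ k i = subst (_< P₃ k i) (P₂≡ k i) (phase-order (lowEnd<highEnd k) (inPhase k i j2) (inPhase k i j3))

  groupProfile : ℕ → Fin m → Fin H → Profile
  groupProfile t k i = profileAt t (P₁ k i) (P₃ k i)

  requestChain : ∀ (f : Kind → Page n m H) x₁ x₂ x₃ x₄ x₅ x₆ {y₁ y₂ y₃ y₄ y₅} →
    (if x₁ then (f ā ∷ [] , [])
     else if x₂ then (f ā ∷ f α ∷ [] , f b ∷ [])
     else if x₃ then (f α ∷ f a ∷ [] , f b ∷ [])
     else if x₄ then (f a ∷ [] , f b ∷ [])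
     else if x₅ then (f a ∷ [] , f b ∷ f β ∷ [])
     else if x₆ then (f a ∷ [] , f β ∷ f b̄ ∷ [])
     else ([] , f b̄ ∷ [])) ≡ mapPair f (requestPattern (profile x₁ x₂ x₃ x₄ x₅ x₆ y₁ y₂ y₃ y₄ y₅))
  requestChain f true x₂ x₃ x₄ x₅ x₆ = refl
  requestChain f false true x₃ x₄ x₅ x₆ = refl
  requestChain f false false true x₄ x₅ x₆ = refl
  requestChain f false false false true x₅ x₆ = refl
  requestChain f false false false false true x₆ = refl
  requestChain f false false false false false true = refl
  requestChain f false false false false false false = refl

  group-shape : ∀ t k i → group t k i ≡ mapPair (λ κ → ep κ k i) (requestPattern (groupProfile t k i))
  group-shape t k i rewrite P₂≡ k i | P₄≡ k i =
    requestChain (λ κ → ep κ k i) (t <ᵇ P₁ k i) (t ≡ᵇ P₁ k i) (t ≡ᵇ suc (P₁ k i))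
                 (t <ᵇ P₃ k i) (t ≡ᵇ P₃ k i) (t ≡ᵇ suc (P₃ k i))
                 {t ≡ᵇ 0} {t ≤ᵇ P₁ k i} {t ≤ᵇ suc (P₃ k i)} {t ≤ᵇ P₃ k i} {t <ᵇ suc (P₃ k i)}

  -- the spare blocks of a group under strategy s lie in the phase of spareOwner k s
  spareOwner : Fin m → Bool → Fin n
  spareOwner k s = if s then lowEnd k else highEnd k

  named-by-pos : ∀ {x} k i j → x ∈ blockNames → pos x ≡ pos (blk k i j) → x ≡ blk k i j
  named-by-pos k i j x∈ e = pos-injective x∈ (inBlockNames (inPhase k i j)) e

  spare-block : ∀ s k i x → x ∈ blockNames → spare s (groupProfile (pos x) k i) ≡ 1 →
                Σ J (λ j → x ≡ blk k i j × owner k j ≡ spareOwner k s)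
  spare-block true k i x x∈ e with ∨-true (bit-1 e)
  ... | inj₁ q = j1 , named-by-pos k i j1 x∈ (≡ᵇ⇒≡ _ _ (≡true⇒T q)) , refl
  ... | inj₂ q = j2 , named-by-pos k i j2 x∈ (trans (≡ᵇ⇒≡ _ _ (≡true⇒T q)) (sym (P₂≡ k i))) , refl
  spare-block false k i x x∈ e with ∨-true (bit-1 e)
  ... | inj₁ q = j3 , named-by-pos k i j3 x∈ (≡ᵇ⇒≡ _ _ (≡true⇒T q)) , refl
  ... | inj₂ q = j4 , named-by-pos k i j4 x∈ (trans (≡ᵇ⇒≡ _ _ (≡true⇒T q)) (sym (P₄≡ k i))) , refl

  data StartsPhase : BN → Set where
    startF : StartsPhase bF
    startLow : ∀ {k i} → StartsPhase (blk k i j1)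
    startHigh : ∀ {k i} → StartsPhase (blk k i j3)

  noSpareAtStart : ∀ s y → y ∈ blockNames → StartsPhase y → ∀ k i → spareAtStart s (groupProfile (pos y) k i) ≡ 0
  noSpareAtStart true y y∈ st k i =
    bit-0 (λ q → notB₂ (subst StartsPhase (named-by-pos k i j2 y∈ (trans (≡ᵇ⇒≡ _ _ (≡true⇒T q)) (sym (P₂≡ k i)))) st))
    where
      notB₂ : ¬ StartsPhase (blk k i j2)
      notB₂ ()
  noSpareAtStart false y y∈ st k i =
    bit-0 (λ q → notB₄ (subst StartsPhase (named-by-pos k i j4 y∈ (trans (≡ᵇ⇒≡ _ _ (≡true⇒T q)) (sym (P₄≡ k i)))) st))
    where
      notB₄ : ¬ StartsPhase (blk k i j4)
      notB₄ ()

  Starts : List BN → Set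
  Starts [] = ⊤
  Starts (y ∷ _) = StartsPhase y

  Starts-++ : ∀ A B → Starts A → Starts B → Starts (A ++ B)
  Starts-++ [] B _ sB = sB
  Starts-++ (x ∷ A) B sA _ = sA

  Starts-concatMap : ∀ {C : Set} (f : C → List BN) cs → (∀ c → Starts (f c)) → Starts (concatMap f cs)
  Starts-concatMap f [] _ = tt
  Starts-concatMap f (c ∷ cs) h = Starts-++ (f c) _ (h c) (Starts-concatMap f cs h)

  Starts-phase : ∀ v → Starts (phaseBlocks v)
  Starts-phase v = Starts-concatMap (edgeBlocks v) (inc v) (λ k → Starts-concatMap (pairBlocks v k) (allFin H) (pairStarts k))
    where
      pairStarts : ∀ k i → Starts (pairBlocks v k i)
      pairStarts k i with ⌊ v ≟ lowEnd k ⌋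
      ... | true = startLow
      ... | false = startHigh

  noSpareAtBoundary : ∀ A ws → blockNames ≡ A ++ (concatMap phaseBlocks ws ++ bF ∷ []) →
                      ∀ s k i → spareAtStart s (groupProfile (length A) k i) ≡ 0
  noSpareAtBoundary A ws e s k i
    with concatMap phaseBlocks ws ++ bF ∷ [] in rest
       | Starts-++ (concatMap phaseBlocks ws) (bF ∷ []) (Starts-concatMap phaseBlocks ws Starts-phase) startF
  ... | [] | _ = case (++-conicalʳ (concatMap phaseBlocks ws) (bF ∷ []) rest) of λ ()
  ... | y ∷ Z | st = subst (λ t → spareAtStart s (groupProfile t k i) ≡ 0) (pos-at y A Z e)
                       (noSpareAtStart s y (subst (y ∈_) (sym e) (∈-++⁺ʳ A (here refl))) st k i)

  -- there are at least 4mH phase blocks, since the blocks of distinct groups are distinct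
  groupBlocks : Fin m → Fin H → List BN
  groupBlocks k i = blk k i j1 ∷ blk k i j2 ∷ blk k i j3 ∷ blk k i j4 ∷ []

  groupBlocks-named : ∀ {k i z} → z ∈ groupBlocks k i → Σ J (λ j → z ≡ blk k i j)
  groupBlocks-named (here e) = j1 , e
  groupBlocks-named (there (here e)) = j2 , e
  groupBlocks-named (there (there (here e))) = j3 , e
  groupBlocks-named (there (there (there (here e)))) = j4 , e

  allGroupBlocks : List BN
  allGroupBlocks = concatMap (λ k → concatMap (groupBlocks k) (allFin H)) (allFin m)

  Unique-allGroupBlocks : Unique allGroupBlocks
  Unique-allGroupBlocks = Unique-concatMap _ (Unique.allFin⁺ m)
    (λ k → Unique-concatMap (groupBlocks k) (Unique.allFin⁺ H)
       (λ i → ((λ ()) ∷ (λ ()) ∷ (λ ()) ∷ []) ∷ ((λ ()) ∷ (λ ()) ∷ []) ∷ ((λ ()) ∷ []) ∷ [] ∷ [])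
       (λ q q' → let (_ , e) = groupBlocks-named q ; (_ , e') = groupBlocks-named q'
                 in proj₁ (proj₂ (blk-injective (trans (sym e) e')))))
    (λ {k} {k'} q q' →
       let (_ , _ , q₁) = find (∈-concatMap⁻ (groupBlocks k) {xs = allFin H} q)
           (_ , _ , q₁') = find (∈-concatMap⁻ (groupBlocks k') {xs = allFin H} q')
           (_ , e) = groupBlocks-named q₁ ; (_ , e') = groupBlocks-named q₁'
       in proj₁ (blk-injective (trans (sym e) e')))

  allGroupBlocks⊆phaseList : ∀ {x} → x ∈ allGroupBlocks → x ∈ phaseList
  allGroupBlocks⊆phaseList q =
    let (k , _ , q₁) = find (∈-concatMap⁻ (λ k → concatMap (groupBlocks k) (allFin H)) {xs = allFin m} q)
        (i , _ , q₂) = find (∈-concatMap⁻ (groupBlocks k) {xs = allFin H} q₁)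
        (j , e) = groupBlocks-named q₂
    in subst (_∈ phaseList) (sym e) (inPhaseList (inPhase k i j))

  phaseList-length : m * (H * 4) ≤ length phaseList
  phaseList-length = subst (_≤ length phaseList) length-allGroupBlocks
                       (Unique⊆⇒length≤ Unique-allGroupBlocks allGroupBlocks⊆phaseList)
    where
      length-allFin : ∀ N → length (allFin N) ≡ N
      length-allFin N = length-tabulate (λ x → x)
      length-allGroupBlocks : length allGroupBlocks ≡ m * (H * 4)
      length-allGroupBlocks =
        trans (length-concatMap-const _ (H * 4) (allFin m)
                 (λ k → trans (length-concatMap-const (groupBlocks k) 4 (allFin H) (λ _ → refl)) (cong (_* 4) (length-allFin H))))
              (cong (_* (H * 4)) (length-allFin m))

-- The vertex page p_v is loaded at
-- its first request iff v ∈ S and evicted at its second; group (k , i)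
-- follows the strategy “lowEnd k ∉ S”, so its two spare blocks lie in the
-- phase of a vertex outside S (by independence).  Hence inside the v-phase
-- either p_v occupies the one free unit of the cache (v ∈ S), or at most
-- one group, the one owning the current block, uses it (v ∉ S).
module Serving {n m : ℕ} (G : Graph n m) (O : IncidenceOrder G) (H : ℕ)
               (S : Subset n) (independent : Graph.IndependentSet G S) where
  open Graph G
  open IncidenceOrder O
  open Instance G O H
  open Blocks G O H
  open OneGroup

  inS : Fin n → Bool
  inS v = vlookup S v

  strategy : Fin m → Bool
  strategy k = not (inS (lowEnd k))

  spareOwner-outside : ∀ k → inS (spareOwner k (strategy k)) ≡ false
  spareOwner-outside k with inS (lowEnd k) in low
  ... | false = low
  ... | true with inS (highEnd k) in high
  ...   | false = refl
  ...   | true = ⊥-elim (independent-ends independent k (lookup⇒[]= _ S low) (lookup⇒[]= _ S high))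

  Pg : Set
  Pg = Page n m H

  record SimState : Set where
    constructor state
    field
      slot : Fin m → Fin H → Slot
      vertexIn : Fin n → Bool
  open SimState

  cached : SimState → Pg → Bool
  cached σ (vtx v) = vertexIn σ v
  cached σ (ep κ k i) = holds (slot σ k i) κ

  -- a request to p_w toggles p_w when w ∈ S; a group page is served by its group's slot
  step : Pg → SimState → SimState
  step (vtx w) σ = state (slot σ) (λ v → if does (v ≟ w) then inS w ∧ not (vertexIn σ w) else vertexIn σ v)
  step (ep κ k i) σ =
    state (λ k' i' → if does (k' ≟ k) ∧ does (i' ≟ i) then serve (strategy k) κ (slot σ k i) else slot σ k' i')
          (vertexIn σ)

  step-gains : ∀ σ r p → cached (step r σ) p ≡ true → cached σ p ≡ true ⊎ p ≡ r
  step-gains σ (vtx w) (vtx v) e with v ≟ w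
  ... | yes refl = inj₂ refl
  ... | no _ = inj₁ e
  step-gains σ (vtx w) (ep κ k i) e = inj₁ e
  step-gains σ (ep κ' k' i') (vtx v) e = inj₁ e
  step-gains σ (ep κ' k' i') (ep κ k i) e with k ≟ k' | i ≟ i'
  ... | yes refl | yes refl with keeps (strategy k) κ'
  ...   | true = inj₂ (cong (λ κ'' → ep κ'' k i) (sym (holds-just e)))
  ...   | false = inj₁ e
  step-gains σ (ep κ' k' i') (ep κ k i) e | yes refl | no _ = inj₁ e
  step-gains σ (ep κ' k' i') (ep κ k i) e | no _ | _ = inj₁ e

  open ServiceFromSimulation (allPages n m H) pageSize pageCost (capacity m H) requests cached step step-gains

  GroupPage : Pg → Set
  GroupPage (vtx _) = ⊥
  GroupPage (ep _ _ _) = ⊤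

  groupPart : Fin m → Fin H → List Pg → List Kind
  groupPart k i [] = []
  groupPart k i (vtx _ ∷ l) = groupPart k i l
  groupPart k i (ep κ k' i' ∷ l) = if does (k ≟ k') ∧ does (i ≟ i') then κ ∷ groupPart k i l else groupPart k i l

  slot-run : ∀ l σ k i → slot (run σ l) k i ≡ runSlot (strategy k) (slot σ k i) (groupPart k i l)
  slot-run [] σ k i = refl
  slot-run (vtx w ∷ l) σ k i = slot-run l (step (vtx w) σ) k i
  slot-run (ep κ k' i' ∷ l) σ k i = trans (slot-run l (step (ep κ k' i') σ) k i) (matches (k ≟ k') (i ≟ i'))
    where
      matches : ∀ (dk : Dec (k ≡ k')) (di : Dec (i ≡ i')) →
        runSlot (strategy k) (if does dk ∧ does di then serve (strategy k') κ (slot σ k' i') else slot σ k i) (groupPart k i l)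
        ≡ runSlot (strategy k) (slot σ k i) (if does dk ∧ does di then κ ∷ groupPart k i l else groupPart k i l)
      matches (yes refl) (yes refl) = refl
      matches (yes _) (no _) = refl
      matches (no _) _ = refl

  vertexIn-run : ∀ l σ → All GroupPage l → vertexIn (run σ l) ≡ vertexIn σ
  vertexIn-run [] σ _ = refl
  vertexIn-run (ep κ k i ∷ l) σ (_ ∷ gl) = vertexIn-run l (step (ep κ k i) σ) gl

  saved-groups : ∀ l σ → All GroupPage l → saved σ l ≡ ∑∑ (λ k i → slotHits (strategy k) (slot σ k i) (groupPart k i l))
  saved-groups [] σ _ = sym (∑∑-zero m H)
  saved-groups (ep κ k' i' ∷ l) σ (_ ∷ gl) = begin
      X + saved σ' l                    ≡⟨ cong (X +_) (saved-groups l σ' gl) ⟩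
      X + ∑∑ F                          ≡⟨ +-comm X (∑∑ F) ⟩
      ∑∑ F + X                          ≡⟨ cong (∑∑ F +_) (∑∑-pointMass₂ k' i' X) ⟨
      ∑∑ F + ∑∑ (pointMass₂ k' i' X)    ≡⟨ ∑∑-+ F (pointMass₂ k' i' X) ⟨
      ∑∑ (λ k i → F k i + pointMass₂ k' i' X k i)
        ≡⟨ ∑∑-cong (λ k i → matches k i (k ≟ k') (i ≟ i')) ⟩
      ∑∑ (λ k i → slotHits (strategy k) (slot σ k i) (groupPart k i (ep κ k' i' ∷ l)))
    ∎
    where
      open ≡-Reasoning
      σ' = step (ep κ k' i') σ
      X = bit (holds (slot σ k' i') κ)
      F : Fin m → Fin H → ℕ
      F k i = slotHits (strategy k) (slot σ' k i) (groupPart k i l)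
      matches : ∀ k i (dk : Dec (k ≡ k')) (di : Dec (i ≡ i')) →
        slotHits (strategy k) (if does dk ∧ does di then serve (strategy k') κ (slot σ k' i') else slot σ k i) (groupPart k i l)
          + (if does dk then (if does di then X else 0) else 0)
        ≡ slotHits (strategy k) (slot σ k i) (if does dk ∧ does di then κ ∷ groupPart k i l else groupPart k i l)
      matches k i (yes refl) (yes refl) = +-comm _ X
      matches k i (yes refl) (no _) = +-identityʳ _
      matches k i (no _) _ = +-identityʳ _

  groupPart-++ : ∀ k i xs ys → groupPart k i (xs ++ ys) ≡ groupPart k i xs ++ groupPart k i ys
  groupPart-++ k i [] ys = refl
  groupPart-++ k i (vtx _ ∷ xs) ys = groupPart-++ k i xs ys
  groupPart-++ k i (ep κ k' i' ∷ xs) ys with does (k ≟ k') ∧ does (i ≟ i')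
  ... | true = cong (κ ∷_) (groupPart-++ k i xs ys)
  ... | false = groupPart-++ k i xs ys

  groupPart-concatMap : ∀ {A : Set} k i (g : A → List Pg) xs →
                        groupPart k i (concatMap g xs) ≡ concatMap (λ x → groupPart k i (g x)) xs
  groupPart-concatMap k i g [] = refl
  groupPart-concatMap k i g (x ∷ xs) =
    trans (groupPart-++ k i (g x) (concatMap g xs)) (cong (groupPart k i (g x) ++_) (groupPart-concatMap k i g xs))

  groupPart-take : ∀ k i l j → ∃ λ j' → groupPart k i (take j l) ≡ take j' (groupPart k i l)
  groupPart-take k i l zero = 0 , refl
  groupPart-take k i [] (suc j) = 0 , refl
  groupPart-take k i (vtx _ ∷ l) (suc j) = groupPart-take k i l j
  groupPart-take k i (ep κ k' i' ∷ l) (suc j) with does (k ≟ k') ∧ does (i ≟ i')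
  ... | true = let (j' , e) = groupPart-take k i l j in suc j' , cong (κ ∷_) e
  ... | false = groupPart-take k i l j

  groupPart-own : ∀ k₀ i₀ k i κs →
                  groupPart k₀ i₀ (map (λ κ → ep κ k i) κs) ≡ (if does (k₀ ≟ k) ∧ does (i₀ ≟ i) then κs else [])
  groupPart-own k₀ i₀ k i [] with does (k₀ ≟ k) ∧ does (i₀ ≟ i)
  ... | true = refl
  ... | false = refl
  groupPart-own k₀ i₀ k i (κ ∷ κs) with does (k₀ ≟ k) ∧ does (i₀ ≟ i) | groupPart-own k₀ i₀ k i κs
  ... | true | e = cong (κ ∷_) e
  ... | false | e = e

  -- one round (first: w = true, second: w = false) of a request pair
  round : ∀ {A : Set} → Bool → List A × List A → List A
  round true = proj₁
  round false = proj₂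

  groupPart-round : ∀ w t k₀ i₀ k →
    groupPart k₀ i₀ (concatMap (λ i → round w (group t k i)) (allFin H))
    ≡ concatMap (λ i → if does (k₀ ≟ k) ∧ does (i₀ ≟ i) then round w (requestPattern (groupProfile t k i)) else []) (allFin H)
  groupPart-round w t k₀ i₀ k =
    trans (groupPart-concatMap k₀ i₀ (λ i → round w (group t k i)) (allFin H))
          (concatMap-cong (λ i → trans (cong (groupPart k₀ i₀ ∘ round w) (group-shape t k i))
                                       (trans (cong (groupPart k₀ i₀) (round-map w i)) (groupPart-own k₀ i₀ k i _))) (allFin H))
    where
      round-map : ∀ w i {p} → round w (mapPair (λ κ → ep κ k i) p) ≡ map (λ κ → ep κ k i) (round w p)
      round-map true i = refl
      round-map false i = refl

  groupPart-round-other : ∀ w t k₀ i₀ k → k ≢ k₀ → groupPart k₀ i₀ (concatMap (λ i → round w (group t k i)) (allFin H)) ≡ []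
  groupPart-round-other w t k₀ i₀ k k≢k₀ =
    trans (groupPart-round w t k₀ i₀ k)
          (concatMap-[] _ (allFin H) (λ i → cong (λ c → if c ∧ does (i₀ ≟ i) then round w (requestPattern (groupProfile t k i)) else [])
                                                 (dec-false (k₀ ≟ k) (k≢k₀ ∘ sym))))

  groupPart-round-own : ∀ w t k₀ i₀ →
    groupPart k₀ i₀ (concatMap (λ i → round w (group t k₀ i)) (allFin H)) ≡ round w (requestPattern (groupProfile t k₀ i₀))
  groupPart-round-own w t k₀ i₀ =
    trans (groupPart-round w t k₀ i₀ k₀)
          (trans (concatMap-allFin-select _ i₀ (λ i i≢i₀ → cong₂ (pick i) (dec-true (k₀ ≟ k₀) refl) (dec-false (i₀ ≟ i) (i≢i₀ ∘ sym))))
                 (cong₂ (pick i₀) (dec-true (k₀ ≟ k₀) refl) (dec-true (i₀ ≟ i₀) refl)))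
    where
      pick : Fin H → Bool → Bool → List Kind
      pick i c d = if c ∧ d then round w (requestPattern (groupProfile t k₀ i)) else []

  groupPart-content : ∀ t k₀ i₀ → groupPart k₀ i₀ (content t) ≡ requestsOf (groupProfile t k₀ i₀)
  groupPart-content t k₀ i₀ = begin
      groupPart k₀ i₀ (content t)
    ≡⟨ groupPart-concatMap k₀ i₀ (λ k → rounds true k ++ rounds false k) (allFin m) ⟩
      concatMap (λ k → groupPart k₀ i₀ (rounds true k ++ rounds false k)) (allFin m)
    ≡⟨ concatMap-allFin-select _ k₀ (λ k k≢k₀ → trans (groupPart-++ k₀ i₀ (rounds true k) (rounds false k))
         (cong₂ _++_ (groupPart-round-other true t k₀ i₀ k k≢k₀) (groupPart-round-other false t k₀ i₀ k k≢k₀))) ⟩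
      groupPart k₀ i₀ (rounds true k₀ ++ rounds false k₀)
    ≡⟨ groupPart-++ k₀ i₀ (rounds true k₀) (rounds false k₀) ⟩
      groupPart k₀ i₀ (rounds true k₀) ++ groupPart k₀ i₀ (rounds false k₀)
    ≡⟨ cong₂ _++_ (groupPart-round-own true t k₀ i₀) (groupPart-round-own false t k₀ i₀) ⟩
      requestsOf (groupProfile t k₀ i₀)
    ∎
    where
      open ≡-Reasoning
      rounds : Bool → Fin m → List Pg
      rounds w k = concatMap (λ i → round w (group t k i)) (allFin H)

  content-groupPages : ∀ t → All GroupPage (content t)
  content-groupPages t = All-concatMap _ (allFin m) (λ k → All.++⁺ (rounds true k) (rounds false k))
    where
      rounds : ∀ w k → All GroupPage (concatMap (λ i → round w (group t k i)) (allFin H))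
      rounds w k = All-concatMap _ (allFin H) (λ i → subst (All GroupPage) (sym (cong (round w) (group-shape t k i)))
                     (roundPages w i (requestPattern (groupProfile t k i))))
        where
          roundPages : ∀ w i p → All GroupPage (round w (mapPair (λ κ → ep κ k i) p))
          roundPages true i p = All.map⁺ (All.tabulate (λ _ → tt))
          roundPages false i p = All.map⁺ (All.tabulate (λ _ → tt))

  vertexCount : SimState → ℕ
  vertexCount σ = ∑ (λ v → bit (vertexIn σ v))

  occupied : SimState → Pg → ℕ
  occupied σ p = if cached σ p then pageSize p else 0

  kinds : List Kind
  kinds = ā ∷ α ∷ a ∷ b ∷ β ∷ b̄ ∷ []

  slotSize-by-kinds : ∀ σ k i → sum (map (λ κ → occupied σ (ep κ k i)) kinds) ≡ slotSize (slot σ k i)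
  slotSize-by-kinds σ k i with slot σ k i
  ... | nothing = refl
  ... | just ā = refl
  ... | just α = refl
  ... | just a = refl
  ... | just b = refl
  ... | just β = refl
  ... | just b̄ = refl

  totalSize-split : ∀ σ → totalSize (cached σ) ≡ vertexCount σ + ∑∑ (λ k i → slotSize (slot σ k i))
  totalSize-split σ = begin
      sum (map (occupied σ) (map vtx (allFin n) ++ groupPages))
    ≡⟨ sum-map-++ (occupied σ) (map vtx (allFin n)) groupPages ⟩
      sum (map (occupied σ) (map vtx (allFin n))) + sum (map (occupied σ) groupPages)
    ≡⟨ cong₂ _+_ (trans (cong sum (sym (map-∘ (allFin n)))) (sum-map-allFin n (occupied σ ∘ vtx))) slotsPart ⟩
      vertexCount σ + ∑∑ (λ k i → slotSize (slot σ k i))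
    ∎
    where
      open ≡-Reasoning
      pagesOf : Kind → List Pg
      pagesOf κ = concatMap (λ k → map (ep κ k) (allFin H)) (allFin m)
      groupPages : List Pg
      groupPages = concatMap pagesOf kinds
      kindPart : ∀ κ → sum (map (occupied σ) (pagesOf κ)) ≡ ∑∑ (λ k i → occupied σ (ep κ k i))
      kindPart κ = trans (sum-map-concatMap (occupied σ) (λ k → map (ep κ k) (allFin H)) (allFin m))
        (trans (sum-map-cong (λ k → trans (cong sum (sym (map-∘ (allFin H)))) (sum-map-allFin H _)) (allFin m))
               (sum-map-allFin m _))
      slotsPart : sum (map (occupied σ) groupPages) ≡ ∑∑ (λ k i → slotSize (slot σ k i))
      slotsPart = trans (sum-map-concatMap (occupied σ) pagesOf kinds)
        (trans (sum-map-cong kindPart kinds)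
               (trans (sum-map-∑∑ (λ κ k i → occupied σ (ep κ k i)) kinds) (∑∑-cong (slotSize-by-kinds σ))))

  fits-by-bounds : ∀ σ c (e : Fin m → Fin H → ℕ) → vertexCount σ ≤ c →
                   (∀ k i → slotSize (slot σ k i) ≤ 2 + e k i) → c + ∑∑ e ≤ 1 → Fits σ
  fits-by-bounds σ c e vertices≤ slots≤ room = begin
      totalSize (cached σ)
    ≡⟨ totalSize-split σ ⟩
      vertexCount σ + ∑∑ (λ k i → slotSize (slot σ k i))
    ≤⟨ +-mono-≤ vertices≤ (∑∑-mono slots≤) ⟩
      c + ∑∑ (λ k i → 2 + e k i)
    ≡⟨ cong (c +_) (trans (∑∑-+ (λ _ _ → 2) e) (cong (_+ ∑∑ e) (∑∑-const m H 2))) ⟩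
      c + (m * (H * 2) + ∑∑ e)
    ≡⟨ rearrange c (m * (H * 2)) (∑∑ e) ⟩
      m * (H * 2) + (c + ∑∑ e)
    ≤⟨ +-mono-≤ (≤-reflexive (twice m H)) room ⟩
      2 * m * H + 1
    ∎
    where
      open ≤-Reasoning
      rearrange : ∀ x y z → x + (y + z) ≡ y + (x + z)
      rearrange = solve-∀
      twice : ∀ m H → m * (H * 2) ≡ 2 * m * H
      twice = solve-∀

  scheduled : ℕ → Fin m → Fin H → Slot
  scheduled t k i = slotBefore (strategy k) (groupProfile t k i)

  facts : ∀ t k i → BlockFacts (strategy k) (groupProfile t k i)
  facts t k i = blockFacts (1≤P₁ k i) (P₂<P₃ k i) (strategy k) t

  record AtBlock (σ : SimState) (t : ℕ) (V : Fin n → Bool) : Set where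
    field
      onSchedule : ∀ k i → slot σ k i ≡ scheduled t k i
      vertices   : ∀ v → vertexIn σ v ≡ V v
  open AtBlock

  hitsAt : ℕ → ℕ
  hitsAt t = if t ≡ᵇ 0 then 0 else 1

  mH : ℕ
  mH = ∑∑ {m} {H} (λ _ _ → 1)

  hitsAfterI : ∀ t → 1 ≤ t → ∑∑ {m} {H} (λ _ _ → hitsAt t) ≡ mH
  hitsAfterI (suc t) _ = refl

  record BlockServed (σ : SimState) (t : ℕ) (V : Fin n → Bool) : Set where
    field
      fitsIn : FitsAlong σ (content t)
      hitsIn : saved σ (content t) ≡ ∑∑ {m} {H} (λ _ _ → hitsAt t)
      after  : AtBlock (run σ (content t)) (suc t) V
  open BlockServed

  serveBlock : ∀ t σ V (e : Fin m → Fin H → ℕ) → AtBlock σ t V →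
               (∀ k i → spare (strategy k) (groupProfile t k i) ≤ e k i) → ∑ (bit ∘ V) + ∑∑ e ≤ 1 →
               BlockServed σ t V
  serveBlock t σ V e at spare≤ room = record
    { fitsIn = FitsAlong-prefixes σ c prefixFits
    ; hitsIn = trans (saved-groups c σ pages) (∑∑-cong (λ k i → trans (onOwnPart {k = k} {i} (slotHits (strategy k))) (BlockFacts.hits (facts t k i))))
    ; after = record
        { onSchedule = λ k i → trans (slot-run c σ k i) (trans (onOwnPart {k = k} {i} (runSlot (strategy k)))
                                 (trans (BlockFacts.runs (facts t k i)) (slotAfter-next (strategy k) t (P₁ k i) (P₃ k i))))
        ; vertices = λ v → trans (cong (λ f → f v) (vertexIn-run c σ pages)) (vertices at v) } }
    where
      c = content t
      pages = content-groupPages t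
      onOwnPart : ∀ {A : Set} {k i} (F : Slot → List Kind → A) → F (slot σ k i) (groupPart k i c) ≡ F (scheduled t k i) (requestsOf (groupProfile t k i))
      onOwnPart {k = k} {i} F = cong₂ F (onSchedule at k i) (groupPart-content t k i)
      slotBound : ∀ j k i → slotSize (slot (run σ (take j c)) k i) ≤ 2 + e k i
      slotBound j k i = let (j' , part) = groupPart-take k i c j in begin
          slotSize (slot (run σ (take j c)) k i)
        ≡⟨ cong slotSize (trans (slot-run (take j c) σ k i)
             (cong₂ (runSlot (strategy k)) (onSchedule at k i) (trans part (cong (take j') (groupPart-content t k i))))) ⟩
          slotSize (runSlot (strategy k) (scheduled t k i) (take j' (requestsOf (groupProfile t k i))))
        ≤⟨ BlockFacts.peaks (facts t k i) j' ⟩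
          2 + spare (strategy k) (groupProfile t k i)
        ≤⟨ +-monoʳ-≤ 2 (spare≤ k i) ⟩
          2 + e k i
        ∎ where open ≤-Reasoning
      prefixFits : ∀ j → Fits (run σ (take j c))
      prefixFits j = fits-by-bounds _ (∑ (bit ∘ V)) e
        (≤-reflexive (sum-cong-≗ (λ v → cong bit (trans (cong (λ f → f v) (vertexIn-run (take j c) σ (All.take⁺ j pages)))
                                                         (vertices at v)))))
        (slotBound j) room

  noVertex : Fin n → Bool
  noVertex _ = false

  onlyVertex : Fin n → Fin n → Bool
  onlyVertex w v = if does (v ≟ w) then inS w else false

  count-noVertex : ∑ (bit ∘ noVertex) ≤ 1
  count-noVertex = subst (_≤ 1) (sym (∑-zero n)) z≤n

  count-onlyVertex : ∀ w → ∑ (bit ∘ onlyVertex w) ≡ bit (inS w)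
  count-onlyVertex w = trans (sum-cong-≗ pointwise) (∑-pointMass w (bit (inS w)))
    where
      pointwise : ∀ v → bit (onlyVertex w v) ≡ pointMass w (bit (inS w)) v
      pointwise v with does (v ≟ w)
      ... | true = refl
      ... | false = refl

  -- inside the v-phase, only the group owning the current block may use
  -- its spare unit, and only when v ∉ S
  phaseSpare : ∀ v x (mem : PhaseMember v x) → x ∈ blockNames → ∀ k i →
               spare (strategy k) (groupProfile (pos x) k i)
                 ≤ pointMass₂ (PhaseMember.edgeOf mem) (PhaseMember.groupOf mem) (bit (not (inS v))) k i
  phaseSpare v x (member k₀ i₀ j₀ named owned) x∈ k i with spare-0or1 (strategy k) (groupProfile (pos x) k i)
  ... | inj₁ none = subst (_≤ _) (sym none) z≤n
  ... | inj₂ one with spare-block (strategy k) k i x x∈ one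
  ...   | j , x≡ , spareSide with blk-injective (trans (sym named) x≡)
  ...     | refl , refl , refl = subst (_≤ _) (sym one) (subst (1 ≤_) (sym (pointMass₂-at k i _))
                                   (subst (λ c → 1 ≤ bit (not c)) (sym outside) ≤-refl))
    where
      outside : inS v ≡ false
      outside = trans (cong inS (trans owned spareSide)) (spareOwner-outside k)

  fitsAtBoundary : ∀ σ A ws V → blockNames ≡ A ++ (concatMap phaseBlocks ws ++ bF ∷ []) →
                   AtBlock σ (length A) V → ∑ (bit ∘ V) ≤ 1 → Fits σ
  fitsAtBoundary σ A ws V e at room =
    fits-by-bounds σ (∑ (bit ∘ V)) (λ _ _ → 0)
      (≤-reflexive (sum-cong-≗ (λ v → cong bit (vertices at v)))) slotBound
      (subst (_≤ 1) (sym (trans (cong (∑ (bit ∘ V) +_) (∑∑-zero m H)) (+-identityʳ _))) room)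
    where
      slotBound : ∀ k i → slotSize (slot σ k i) ≤ 2 + 0
      slotBound k i = begin
          slotSize (slot σ k i)
        ≡⟨ cong slotSize (onSchedule at k i) ⟩
          slotSize (scheduled (length A) k i)
        ≤⟨ BlockFacts.starts (facts (length A) k i) ⟩
          2 + spareAtStart (strategy k) (groupProfile (length A) k i)
        ≡⟨ cong (2 +_) (noSpareAtBoundary A ws e (strategy k) k i) ⟩
          2 + 0
        ∎ where open ≤-Reasoning

  servePhase : ∀ v xs A Z σ → blockNames ≡ A ++ (xs ++ Z) → (∀ {x} → x ∈ xs → x ∈ phaseBlocks v) → 1 ≤ length A →
               AtBlock σ (length A) (onlyVertex v) → Fits σ →
               FitsAlong σ (concatMap contentOf xs) × saved σ (concatMap contentOf xs) ≡ length xs * mH ×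
               AtBlock (run σ (concatMap contentOf xs)) (length A + length xs) (onlyVertex v)
  servePhase v [] A Z σ e xs⊆ 1≤A at fit = fit , refl , subst (λ t → AtBlock σ t (onlyVertex v)) (sym (+-identityʳ _)) at
  servePhase v (x ∷ xs) A Z σ e xs⊆ 1≤A at fit =
      FitsAlong-++ σ (content (pos x)) rest (fitsIn B) (proj₁ IH) ,
      trans (saved-++ σ (content (pos x)) rest)
            (cong₂ _+_ (trans (hitsIn B) (hitsAfterI (pos x) (subst (1 ≤_) (sym x-pos) 1≤A))) (proj₁ (proj₂ IH))) ,
      subst₂ (λ σ'' t → AtBlock σ'' t (onlyVertex v)) (sym (run-++ σ (content (pos x)) rest)) lengths (proj₂ (proj₂ IH))
    where
      rest = concatMap contentOf xs
      x-pos : pos x ≡ length A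
      x-pos = pos-at x A (xs ++ Z) e
      x∈ : x ∈ blockNames
      x∈ = subst (x ∈_) (sym e) (∈-++⁺ʳ A (here refl))
      mem = phaseMember v x (xs⊆ (here refl))
      room : ∑ (bit ∘ onlyVertex v) + ∑∑ (pointMass₂ (PhaseMember.edgeOf mem) (PhaseMember.groupOf mem) (bit (not (inS v)))) ≤ 1
      room = ≤-reflexive (trans (cong₂ _+_ (count-onlyVertex v) (∑∑-pointMass₂ (PhaseMember.edgeOf mem) (PhaseMember.groupOf mem) _))
                                (bit+bit-not (inS v)))
      B = serveBlock (pos x) σ (onlyVertex v) _ (subst (λ t → AtBlock σ t (onlyVertex v)) (sym x-pos) at)
                     (phaseSpare v x mem x∈) room
      σ' = run σ (content (pos x))
      IH = servePhase v xs (A ++ x ∷ []) Z σ' (trans e (sym (++-assoc A (x ∷ []) (xs ++ Z)))) (xs⊆ ∘ there)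
             (subst (1 ≤_) (sym (length-snoc A x)) (s≤s z≤n))
             (subst (λ t → AtBlock σ' t (onlyVertex v)) (trans (cong suc x-pos) (sym (length-snoc A x))) (after B))
             (FitsAlong-last σ (content (pos x)) (fitsIn B))
      lengths : length (A ++ x ∷ []) + length xs ≡ length A + suc (length xs)
      lengths = trans (cong (_+ length xs) (length-snoc A x)) (sym (+-suc (length A) (length xs)))

  visit : Fin n → List Pg
  visit w = vtx w ∷ (concatMap contentOf (phaseBlocks w) ++ vtx w ∷ [])

  after-phase : ∀ {A w ws} → blockNames ≡ A ++ (concatMap phaseBlocks (w ∷ ws) ++ bF ∷ []) →
                blockNames ≡ (A ++ phaseBlocks w) ++ (concatMap phaseBlocks ws ++ bF ∷ [])
  after-phase {A} {w} {ws} e = trans e (trans (cong (A ++_) (++-assoc (phaseBlocks w) (concatMap phaseBlocks ws) (bF ∷ [])))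
                                             (sym (++-assoc A (phaseBlocks w) _)))

  onlyVertex≤1 : ∀ w → ∑ (bit ∘ onlyVertex w) ≤ 1
  onlyVertex≤1 w = subst (_≤ 1) (sym (count-onlyVertex w)) (bit≤1 (inS w))

  openVertex : ∀ {σ t} w → AtBlock σ t noVertex → AtBlock (step (vtx w) σ) t (onlyVertex w)
  openVertex {σ} w at = record { onSchedule = onSchedule at ; vertices = opened }
    where
      opened : ∀ u → vertexIn (step (vtx w) σ) u ≡ onlyVertex w u
      opened u rewrite vertices at w with does (u ≟ w)
      ... | true = ∧-identityʳ (inS w)
      ... | false = vertices at u

  cachedOwnVertex : ∀ {σ t} w → AtBlock σ t (onlyVertex w) → vertexIn σ w ≡ inS w
  cachedOwnVertex w at = trans (vertices at w) (cong (λ c → if c then inS w else false) (dec-true (w ≟ w) refl))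

  closeVertex : ∀ {σ t} w → AtBlock σ t (onlyVertex w) → AtBlock (step (vtx w) σ) t noVertex
  closeVertex {σ} w at = record { onSchedule = onSchedule at ; vertices = closed }
    where
      closed : ∀ u → vertexIn (step (vtx w) σ) u ≡ false
      closed u with u ≟ w
      ... | yes refl = trans (cong (λ c → inS u ∧ not c) (cachedOwnVertex u at)) (∧-inverseʳ (inS u))
      ... | no u≢w = trans (vertices at u) (cong (λ c → if c then inS w else false) (dec-false (u ≟ w) u≢w))

  serveVertex : ∀ w ws A σ → blockNames ≡ A ++ (concatMap phaseBlocks (w ∷ ws) ++ bF ∷ []) → 1 ≤ length A →
                AtBlock σ (length A) noVertex →
                FitsAlong σ (visit w) × saved σ (visit w) ≡ length (phaseBlocks w) * mH + bit (inS w) ×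
                AtBlock (run σ (visit w)) (length (A ++ phaseBlocks w)) noVertex
  serveVertex w ws A σ e 1≤A at =
      (fitsAtBoundary σ A (w ∷ ws) noVertex e at count-noVertex ,
       FitsAlong-++ σ₁ phase (vtx w ∷ []) (proj₁ P)
         (fitsAtBoundary σ₂ A' ws (onlyVertex w) e' at₂ (onlyVertex≤1 w) ,
          fitsAtBoundary (step (vtx w) σ₂) A' ws noVertex e' (closeVertex w at₂) count-noVertex)) ,
      hits ,
      subst (λ σ'' → AtBlock σ'' (length A') noVertex) (sym (run-++ σ₁ phase (vtx w ∷ []))) (closeVertex w at₂)
    where
      phase = concatMap contentOf (phaseBlocks w)
      A' = A ++ phaseBlocks w
      e' = after-phase {A} {w} {ws} e
      σ₁ = step (vtx w) σ
      P = servePhase w (phaseBlocks w) A (concatMap phaseBlocks ws ++ bF ∷ []) σ₁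
            (trans e (cong (A ++_) (++-assoc (phaseBlocks w) (concatMap phaseBlocks ws) (bF ∷ []))))
            (λ q → q) 1≤A (openVertex w at)
            (fitsAtBoundary σ₁ A (w ∷ ws) (onlyVertex w) e (openVertex w at) (onlyVertex≤1 w))
      σ₂ = run σ₁ phase
      at₂ : AtBlock σ₂ (length A') (onlyVertex w)
      at₂ = subst (λ t → AtBlock σ₂ t (onlyVertex w)) (sym (length-++ A)) (proj₂ (proj₂ P))
      hits : saved σ (visit w) ≡ length (phaseBlocks w) * mH + bit (inS w)
      hits = begin
          bit (vertexIn σ w) + saved σ₁ (phase ++ vtx w ∷ [])
        ≡⟨ cong₂ _+_ (cong bit (vertices at w)) (saved-++ σ₁ phase (vtx w ∷ [])) ⟩
          saved σ₁ phase + (bit (vertexIn σ₂ w) + 0)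
        ≡⟨ cong₂ (λ x y → x + (y + 0)) (proj₁ (proj₂ P)) (cong bit (cachedOwnVertex w at₂)) ⟩
          length (phaseBlocks w) * mH + (bit (inS w) + 0)
        ≡⟨ cong (length (phaseBlocks w) * mH +_) (+-identityʳ _) ⟩
          length (phaseBlocks w) * mH + bit (inS w)
        ∎ where open ≡-Reasoning

  serveFrom : ∀ ws A σ → blockNames ≡ A ++ (concatMap phaseBlocks ws ++ bF ∷ []) → 1 ≤ length A →
              AtBlock σ (length A) noVertex →
              FitsAlong σ (concatMap visit ws ++ contentOf bF) ×
              saved σ (concatMap visit ws ++ contentOf bF)
                ≡ (length (concatMap phaseBlocks ws) + 1) * mH + sum (map (bit ∘ inS) ws)
  serveFrom [] A σ e 1≤A at =
      fitsIn F ,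
      trans (hitsIn F) (trans (hitsAfterI (pos bF) (subst (1 ≤_) (sym F-pos) 1≤A)) (sym (trans (+-identityʳ _) (+-identityʳ mH))))
    where
      F-pos : pos bF ≡ length A
      F-pos = pos-at bF A [] e
      noSpare : ∀ k i → spare (strategy k) (groupProfile (pos bF) k i) ≤ 0
      noSpare k i with spare-0or1 (strategy k) (groupProfile (pos bF) k i)
      ... | inj₁ none = ≤-reflexive none
      ... | inj₂ one = ⊥-elim (bF≢blk (proj₁ (proj₂ (spare-block (strategy k) k i bF (subst (bF ∈_) (sym e) (∈-++⁺ʳ A (here refl))) one))))
      F = serveBlock (pos bF) σ noVertex (λ _ _ → 0) (subst (λ t → AtBlock σ t noVertex) (sym F-pos) at) noSpare
                     (subst (_≤ 1) (sym (cong₂ _+_ (∑-zero n) (∑∑-zero m H))) z≤n)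
  serveFrom (w ∷ ws) A σ e 1≤A at =
      subst (FitsAlong σ) (sym reassoc) (FitsAlong-++ σ (visit w) later (proj₁ V) (proj₁ IH)) ,
      trans (cong (saved σ) reassoc) (trans (saved-++ σ (visit w) later) (trans (cong₂ _+_ (proj₁ (proj₂ V)) (proj₂ IH)) total))
    where
      later = concatMap visit ws ++ contentOf bF
      reassoc : concatMap visit (w ∷ ws) ++ contentOf bF ≡ visit w ++ later
      reassoc = ++-assoc (visit w) (concatMap visit ws) (contentOf bF)
      V = serveVertex w ws A σ e 1≤A at
      IH = serveFrom ws (A ++ phaseBlocks w) (run σ (visit w)) (after-phase {A} {w} {ws} e)
             (≤-trans 1≤A (subst (length A ≤_) (sym (length-++ A)) (m≤m+n _ _))) (proj₂ (proj₂ V))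
      regroup : ∀ x y c d s → x * c + d + ((y + 1) * c + s) ≡ ((x + y) + 1) * c + (d + s)
      regroup = solve-∀
      total : length (phaseBlocks w) * mH + bit (inS w) + ((length (concatMap phaseBlocks ws) + 1) * mH + sum (map (bit ∘ inS) ws))
              ≡ (length (concatMap phaseBlocks (w ∷ ws)) + 1) * mH + sum (map (bit ∘ inS) (w ∷ ws))
      total = trans (regroup (length (phaseBlocks w)) (length (concatMap phaseBlocks ws)) mH (bit (inS w)) (sum (map (bit ∘ inS) ws)))
                    (cong (λ l → (l + 1) * mH + (bit (inS w) + sum (map (bit ∘ inS) ws)))
                          (sym (length-++ (phaseBlocks w))))

  σ₀ : SimState
  σ₀ = state (λ _ _ → nothing) (λ _ → false)

  blockI : BlockServed σ₀ 0 noVertex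
  blockI = serveBlock 0 σ₀ noVertex (λ _ _ → 0)
    (record { onSchedule = λ k i → sym (slotBefore-start (strategy k) (P₁ k i) (P₃ k i)) ; vertices = λ _ → refl })
    (λ k i → ≤-reflexive (spare-start (strategy k) (pred (P₁ k i)) (pred (P₃ k i))))
    (subst (_≤ 1) (sym (cong₂ _+_ (∑-zero n) (∑∑-zero m H))) z≤n)

  servedAfterI : FitsAlong (run σ₀ (content 0)) (concatMap visit (allFin n) ++ contentOf bF) ×
                 saved (run σ₀ (content 0)) (concatMap visit (allFin n) ++ contentOf bF)
                   ≡ (length phaseList + 1) * mH + sum (map (bit ∘ inS) (allFin n))
  servedAfterI = serveFrom (allFin n) (bI ∷ []) (run σ₀ (content 0)) refl (s≤s z≤n) (after blockI)

  fitsAll : FitsAlong σ₀ requests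
  fitsAll = FitsAlong-++ σ₀ (content 0) _ (fitsIn blockI) (proj₁ servedAfterI)

  savedAll : saved σ₀ requests ≡ (length phaseList + 1) * mH + sum (map (bit ∘ inS) (allFin n))
  savedAll = trans (saved-++ σ₀ (content 0) _) (cong₂ _+_ (trans (hitsIn blockI) (∑∑-zero m H)) (proj₂ servedAfterI))

  -- (d - 1)mH + |S| ≤ savings, as 4mH ≤ number of phase blocks
  savedBound : ((4 * m * H + 2) ∸ 1) * m * H + ∣ S ∣ ≤ saved σ₀ requests
  savedBound = begin
      ((4 * m * H + 2) ∸ 1) * m * H + ∣ S ∣
    ≡⟨ cong₂ _+_ blocks (sym (trans (sum-map-allFin n (bit ∘ inS)) (∑-bits S))) ⟩
      (m * (H * 4) + 1) * mH + sum (map (bit ∘ inS) (allFin n))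
    ≤⟨ +-monoˡ-≤ _ (*-monoˡ-≤ mH (+-monoˡ-≤ 1 phaseList-length)) ⟩
      (length phaseList + 1) * mH + sum (map (bit ∘ inS) (allFin n))
    ≡⟨ savedAll ⟨
      saved σ₀ requests
    ∎
    where
      open ≤-Reasoning
      regroup : ∀ m H → (4 * m * H + 1) * m * H ≡ (m * (H * 4) + 1) * (m * (H * 1))
      regroup = solve-∀
      blocks : ((4 * m * H + 2) ∸ 1) * m * H ≡ (m * (H * 4) + 1) * mH
      blocks = trans (cong (λ x → x * m * H) (+-∸-assoc (4 * m * H) (s≤s z≤n)))
                     (trans (regroup m H) (cong ((m * (H * 4) + 1) *_) (sym (∑∑-const m H 1))))

  bestService : Σ Service (λ s → ((4 * m * H + 2) ∸ 1) * m * H + ∣ S ∣ ≤ savings s)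
  bestService = proj₁ served , subst (_ ≤_) (sym (proj₂ served)) savedBound
    where served = service σ₀ (λ { (vtx _) → refl ; (ep _ _ _) → refl }) fitsAll

lemma1 : ∀ {n m : ℕ} (G : Graph n m) (O : IncidenceOrder G) (H : ℕ) → 1 ≤ H →
         (K : ℕ) (S : Subset n) → Graph.IndependentSet G S → ∣ S ∣ ≡ K →
         Σ (Instance.Service G O H)
           (λ s → ((4 * m * H + 2) ∸ 1) * m * H + K ≤ Instance.savings G O H s)
lemma1 G O H _ K S independent refl = Serving.bestService G O H S independent
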